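{- Let $n\ge 11$ and $1\le d\le n-1$ be integers and let $T_{n,d}=\frac{n(n+1)}{2}-d$. If $n$ is odd, then \[ \#\mathbb U^*_{T_{n,d}}= \begin{cases} 1+\#\mathbb D_{(n-d+1)/2} & \text{if } d>3 \text{ is even},\\ \#\mathbb D^{\mathrm{odd}}_{n-d+2} & \text{if } d>3 \text{ is odd},\\ 1 & \text{if } d\in\{1,2,3\}. \end{cases} \] If $n$ is even, then \[ \#\mathbb U^*_{T_{n,d}}= \begin{cases} 1+\#\mathbb D_{(n-d+1)/2} & \text{if } d>2 \text{ is odd},\\ \#\mathbb D^{\mathrm{odd}}_{n-d+2} & \text{if } d>2 \text{ is even},\\ 1 & \text{if } d\in\{1,2\}. \end{cases} \]
   Context: A partition of a positive integer $N$ into distinct parts is a sequence of positive integers $\lambda=(\lambda_1,\dots,\lambda_t)$ with $\lambda_1<\lambda_2<\dots<\lambda_t$, $\sum_i\lambda_i=N$ and $t\ge 2$ (so the one-part sequence $(N)$ is NOT counted). $\mathbb D_N$ denotes the set of all such partitions of $N$, and $\mathbb D_N^{\mathrm{odd}}$ the subset of those all of whose parts are odd. The missing parts of $\lambda$ are the elements of $\{1,2,\dots,\lambda_t\}\setminus\{\lambda_1,\dots,\lambda_t\}$. The partition $\lambda$ is refinable if there exist two distinct missing parts $\mu<\mu'$ of $\lambda$ such that $\mu+\mu'$ is a part of $\lambda$, and unrefinable otherwise; $\mathbb U_N$ is the set of unrefinable partitions of $N$. An unrefinable partition $\lambda\in\mathbb U_N$ is maximal if its largest part $\lambda_t$ equals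 the maximum of the largest parts of all elements of $\mathbb U_N$; $\mathbb U^*_N$ denotes the set of maximal unrefinable partitions of $N$. For a finite set $A$, $\#A$ is its cardinality. -}

module Defs where

open import Data.Nat using (ℕ; zero; suc; _+_; _*_; _∸_; _≤_; _<_; _⊔_)
open import Data.Nat.DivMod using (_/_; _%_)
open import Data.List using (List; []; _∷_; length; foldr)
open import Data.Nat.ListAction using (sum)
open import Data.List.Relation.Unary.All using (All)
open import Data.List.Relation.Unary.Linked using (Linked)
open import Data.List.Relation.Unary.Unique.Propositional using (Unique)
open import Data.List.Membership.Propositional using (_∈_; _∉_)
open import Data.Product using (Σ; ∃; _×_)
open import Relation.Binary.PropositionalEquality using (_≡_)
open import Relation.Nullary using (¬_)

IsDistinctPartition : ℕ → List ℕ → Set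
IsDistinctPartition N l =
  Linked _<_ l × All (λ x → 1 ≤ x) l × sum l ≡ N × 2 ≤ length l

IsOddDistinctPartition : ℕ → List ℕ → Set
IsOddDistinctPartition N l = IsDistinctPartition N l × All (λ x → x % 2 ≡ 1) l

largest : List ℕ → ℕ
largest = foldr _⊔_ 0

Missing : List ℕ → ℕ → Set
Missing l m = 1 ≤ m × m ≤ largest l × m ∉ l

Refinable : List ℕ → Set
Refinable l = Σ ℕ λ μ → Σ ℕ λ μ' →
  Missing l μ × Missing l μ' × μ < μ' × (μ + μ') ∈ l

IsUnrefinable : ℕ → List ℕ → Set
IsUnrefinable N l = IsDistinctPartition N l × ¬ Refinable l

IsMaximalUnrefinable : ℕ → List ℕ → Set
IsMaximalUnrefinable N l =
  IsUnrefinable N l × (∀ l' → IsUnrefinable N l' → largest l' ≤ largest l)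

HasCard : (List ℕ → Set) → ℕ → Set
HasCard P k = Σ (List (List ℕ)) λ xs →
  Unique xs × All P xs × (∀ l → P l → l ∈ xs) × length xs ≡ k

T : ℕ → ℕ → ℕ
T n d = (n * suc n) / 2 ∸ d

-- Let m be the largest part of an unrefinable partition of N. For 2a < m one of a, m − a is a part,
-- since otherwise a + (m − a) = m refines it. Grouping the parts into these pairs gives
-- 2N = k(k + 3) + 2e for m = 2k and 2N = k(k + 5) + 2 + 2e for m = 2k + 1, where the defect e ≥ 0
-- measures by how much the pairs (and the middle part k) exceed their smaller members. For N = T_{n,d}
-- these identities bound m, and at the maximal m the defect is so small that no pair is doubled, except in
-- one boundary configuration. A maximal partition is then determined by which k + b are parts: for m = 2k
-- and k not a part these b form a partition of e/2 into distinct parts, for m = 2k + 1 the numbers 2b − 1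
-- form a partition of e into distinct odd parts. Conversely each such partition yields an unrefinable partition, except for
-- one refinable configuration, whose place is taken by the boundary one when it exists.

module Submission where

open import Defs
open import Data.Nat using (ℕ; zero; suc; _+_; _*_; _∸_; _≤_; _<_; _≡ᵇ_; z≤n; s≤s; _<?_; _≟_; _≤?_)
open import Data.Nat.Properties
open import Data.Nat.DivMod using (_/_; _%_; m≡m%n+[m/n]*n; m*n/n≡m; [m+kn]%n≡m%n)
open import Data.Nat.ListAction using (sum)
open import Data.Nat.Tactic.RingSolver using (solve-∀)
open import Data.Bool using (Bool; true; false; not; _∧_; _∨_)
open import Data.Bool.Properties using (∨-identityʳ; ∨-zeroʳ)
open import Data.List using (List; []; _∷_; length; map)
open import Data.List.Properties using (length-map; ≡-dec)
open import Data.List.Relation.Unary.All.Properties using (map⁺)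
open import Data.List.Relation.Unary.All as All using (All; []; _∷_)
open import Data.List.Relation.Unary.Any using (here; there)
open import Data.List.Relation.Unary.AllPairs using (AllPairs; []; _∷_)
open import Data.List.Relation.Unary.Linked using (Linked; []; [-]; _∷_)
open import Data.List.Relation.Unary.Linked.Properties using (AllPairs⇒Linked; Linked⇒AllPairs)
open import Data.List.Relation.Unary.Unique.Propositional using (Unique)
open import Data.List.Membership.Propositional using (_∈_; _∉_)
open import Data.List.Membership.Propositional.Properties using (∈-map⁺; ∈-map⁻)
open import Data.Product using (Σ; _×_; _,_; proj₁; proj₂)
open import Data.Sum using (_⊎_; inj₁; inj₂; map₁)
open import Data.Empty using (⊥; ⊥-elim)
open import Relation.Binary.PropositionalEquality
open import Relation.Binary.Definitions using (tri<; tri≈; tri>)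
open import Relation.Nullary using (¬_; Dec; yes; no)

+-interchange : ∀ a b c d → (a + b) + (c + d) ≡ (a + c) + (b + d)
+-interchange = solve-∀

[m+o]∸[n+o]≡m∸n : ∀ m n o → (m + o) ∸ (n + o) ≡ m ∸ n
[m+o]∸[n+o]≡m∸n m n o = trans (cong₂ _∸_ (+-comm m o) (+-comm n o)) ([m+n]∸[m+o]≡n∸o o m n)

2*x≡x+x : ∀ x → 2 * x ≡ x + x
2*x≡x+x x = cong (x +_) (+-identityʳ x)

2*x≰x : ∀ x → 1 ≤ x → 2 * x ≤ x → ⊥
2*x≰x x x≥1 2x≤x = n≮n x (<-≤-trans (m<m+n x x≥1) (subst (_≤ x) (2*x≡x+x x) 2x≤x))

∸-cancel : ∀ a b y → a + 1 ≡ b + y → a ∸ y ≡ b ∸ 1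
∸-cancel a b y a+1≡b+y = trans (sym ([m+o]∸[n+o]≡m∸n a y 1)) (trans (cong (_∸ (y + 1)) a+1≡b+y)
  (trans (cong (b + y ∸_) (+-comm y 1)) ([m+o]∸[n+o]≡m∸n b 1 y)))

even-or-odd : ∀ m → (Σ ℕ λ h → m ≡ h + h) ⊎ (Σ ℕ λ h → m ≡ suc (h + h))
even-or-odd zero = inj₁ (0 , refl)
even-or-odd (suc m) with even-or-odd m
... | inj₁ (h , m≡2h) = inj₂ (h , cong suc m≡2h)
... | inj₂ (h , m≡2h+1) = inj₁ (suc h , trans (cong suc m≡2h+1) (cong suc (sym (+-suc h h))))

half-≤ : ∀ {a b} → a + a ≤ suc (b + b) → a ≤ b
half-≤ {a} {b} 2a≤2b+1 with a ≤? b
... | yes a≤b = a≤b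
... | no a≰b = ⊥-elim (n≮n _ (<-≤-trans (subst (_≤ a + a) (+-suc (suc b) b) (+-mono-≤ (≰⇒> a≰b) (≰⇒> a≰b))) 2a≤2b+1))

[h+h]%2≡0 : ∀ h → (h + h) % 2 ≡ 0
[h+h]%2≡0 h = trans (cong (_% 2) (double h)) ([m+kn]%n≡m%n 0 h 2)
  where double : ∀ h → h + h ≡ 0 + h * 2
        double = solve-∀

[1+h+h]%2≡1 : ∀ h → suc (h + h) % 2 ≡ 1
[1+h+h]%2≡1 h = trans (cong (_% 2) (double h)) ([m+kn]%n≡m%n 1 h 2)
  where double : ∀ h → suc (h + h) ≡ 1 + h * 2
        double = solve-∀

≡ᵇ-refl : ∀ x → (x ≡ᵇ x) ≡ true
≡ᵇ-refl zero = refl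
≡ᵇ-refl (suc x) = ≡ᵇ-refl x

≡ᵇ-true⇒≡ : ∀ x y → (x ≡ᵇ y) ≡ true → x ≡ y
≡ᵇ-true⇒≡ zero zero _ = refl
≡ᵇ-true⇒≡ (suc x) (suc y) e = cong suc (≡ᵇ-true⇒≡ x y e)

≢⇒≡ᵇ-false : ∀ x y → x ≢ y → (x ≡ᵇ y) ≡ false
≢⇒≡ᵇ-false x y x≢y with x ≡ᵇ y in eq
... | true = ⊥-elim (x≢y (≡ᵇ-true⇒≡ x y eq))
... | false = refl

true≢false : true ≢ false
true≢false ()

not≡true⇒≡false : ∀ b → not b ≡ true → b ≡ false
not≡true⇒≡false false _ = refl

not≡false⇒≡true : ∀ b → not b ≡ false → b ≡ true
not≡false⇒≡true true _ = refl

mem : ℕ → List ℕ → Bool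
mem x [] = false
mem x (y ∷ ys) = (x ≡ᵇ y) ∨ mem x ys

mem≡true⇒∈ : ∀ x l → mem x l ≡ true → x ∈ l
mem≡true⇒∈ x (y ∷ ys) e with x ≡ᵇ y in eq
... | true = here (≡ᵇ-true⇒≡ x y eq)
... | false = there (mem≡true⇒∈ x ys e)

∈⇒mem≡true : ∀ x l → x ∈ l → mem x l ≡ true
∈⇒mem≡true x (y ∷ ys) (here refl) rewrite ≡ᵇ-refl x = refl
∈⇒mem≡true x (y ∷ ys) (there p) rewrite ∈⇒mem≡true x ys p = ∨-zeroʳ (x ≡ᵇ y)

∉⇒mem≡false : ∀ x l → x ∉ l → mem x l ≡ false
∉⇒mem≡false x l x∉l with mem x l in eq
... | true = ⊥-elim (x∉l (mem≡true⇒∈ x l eq))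
... | false = refl

mem≡false⇒∉ : ∀ x l → mem x l ≡ false → x ∉ l
mem≡false⇒∉ x l e x∈l with () ← trans (sym (∈⇒mem≡true x l x∈l)) e

Increasing : List ℕ → Set
Increasing = Linked _<_

consIf : Bool → ℕ → List ℕ → List ℕ
consIf true x l = x ∷ l
consIf false x l = l

-- select p i c lists the x ∈ [i, i + c) with p x increasingly. Every distinct partition l is
-- select (λ x → mem x l) 1 (largest l), so partitions are handled as predicates on [1, largest l].
select : (ℕ → Bool) → ℕ → ℕ → List ℕ
select p i zero = []
select p i (suc c) = consIf (p i) i (select p (suc i) c)

widen : ∀ {i c x} {A : Set} → suc i ≤ x × x < suc i + c × A → i ≤ x × x < i + suc c × A
widen {i} {c} {x} (i<x , x< , a) = <⇒≤ i<x , subst (x <_) (sym (+-suc i c)) x< , a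

∈-select⁻ : ∀ p i c x → x ∈ select p i c → i ≤ x × x < i + c × p x ≡ true
∈-select⁻ p i (suc c) x x∈ with p i in eq | x∈
... | true | here refl = ≤-refl , m<m+n i (s≤s z≤n) , eq
... | true | there x∈′ = widen (∈-select⁻ p (suc i) c x x∈′)
... | false | x∈′ = widen (∈-select⁻ p (suc i) c x x∈′)

∈-select⁺ : ∀ p i c x → i ≤ x → x < i + c → p x ≡ true → x ∈ select p i c
∈-select⁺ p i zero x i≤x x<i+0 _ = ⊥-elim (n≮n x (<-≤-trans (subst (x <_) (+-identityʳ i) x<i+0) i≤x))
∈-select⁺ p i (suc c) x i≤x x< px with m≤n⇒m<n∨m≡n i≤x
... | inj₂ refl rewrite px = here refl
... | inj₁ i<x with p i
...   | true = there (∈-select⁺ p (suc i) c x i<x (subst (x <_) (+-suc i c) x<) px)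
...   | false = ∈-select⁺ p (suc i) c x i<x (subst (x <_) (+-suc i c) x<) px

select-increasing : ∀ p i c → Increasing (select p i c)
select-increasing p i c = AllPairs⇒Linked (allPairs i c)
  where
  above : ∀ i c → All (i ≤_) (select p i c)
  above i c = All.tabulate (λ x∈ → proj₁ (∈-select⁻ p i c _ x∈))
  allPairs : ∀ i c → AllPairs _<_ (select p i c)
  allPairs i zero = []
  allPairs i (suc c) with p i
  ... | true = above (suc i) c ∷ allPairs (suc i) c
  ... | false = allPairs (suc i) c

select-positive : ∀ p c → All (1 ≤_) (select p 1 c)
select-positive p c = All.tabulate (λ x∈ → proj₁ (∈-select⁻ p 1 c _ x∈))

select-cong : ∀ {p q} i c → (∀ x → i ≤ x → x < i + c → p x ≡ q x) → select p i c ≡ select q i c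
select-cong i zero _ = refl
select-cong {p} {q} i (suc c) p≗q rewrite p≗q i ≤-refl (m<m+n i (s≤s z≤n)) =
  cong (consIf (q i) i) (select-cong (suc i) c (λ x i<x x< → p≗q x (<⇒≤ i<x) (subst (x <_) (sym (+-suc i c)) x<)))

mem-select : ∀ p i c y → i ≤ y → y < i + c → mem y (select p i c) ≡ p y
mem-select p i c y i≤y y< with p y in eq
... | true = ∈⇒mem≡true y _ (∈-select⁺ p i c y i≤y y< eq)
... | false = ∉⇒mem≡false y _ (λ y∈ → true≢false (trans (sym (proj₂ (proj₂ (∈-select⁻ p i c y y∈)))) eq))

∑ : (ℕ → ℕ) → ℕ → ℕ → ℕ
∑ g i zero = 0
∑ g i (suc c) = g i + ∑ g (suc i) c

when : Bool → ℕ → ℕ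
when true v = v
when false v = 0

sum-select : ∀ p i c → sum (select p i c) ≡ ∑ (λ x → when (p x) x) i c
sum-select p i zero = refl
sum-select p i (suc c) with p i
... | true = cong (i +_) (sum-select p (suc i) c)
... | false = sum-select p (suc i) c

sum-map-select : ∀ p f i c → sum (map f (select p i c)) ≡ ∑ (λ x → when (p x) (f x)) i c
sum-map-select p f i zero = refl
sum-map-select p f i (suc c) with p i
... | true = cong (f i +_) (sum-map-select p f (suc i) c)
... | false = sum-map-select p f (suc i) c

∑-cong : ∀ {f g} i c → (∀ x → i ≤ x → x < i + c → f x ≡ g x) → ∑ f i c ≡ ∑ g i c
∑-cong i zero _ = refl
∑-cong i (suc c) f≗g = cong₂ _+_ (f≗g i ≤-refl (m<m+n i (s≤s z≤n)))
  (∑-cong (suc i) c (λ x i<x x< → f≗g x (<⇒≤ i<x) (subst (x <_) (sym (+-suc i c)) x<)))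

∑-zero : ∀ g i c → (∀ x → i ≤ x → x < i + c → g x ≡ 0) → ∑ g i c ≡ 0
∑-zero g i zero _ = refl
∑-zero g i (suc c) g≗0 = cong₂ _+_ (g≗0 i ≤-refl (m<m+n i (s≤s z≤n)))
  (∑-zero g (suc i) c (λ x i<x x< → g≗0 x (<⇒≤ i<x) (subst (x <_) (sym (+-suc i c)) x<)))

∑-split : ∀ g i a b → ∑ g i (a + b) ≡ ∑ g i a + ∑ g (i + a) b
∑-split g i zero b = cong (λ z → ∑ g z b) (sym (+-identityʳ i))
∑-split g i (suc a) b = begin
  g i + ∑ g (suc i) (a + b)                 ≡⟨ cong (g i +_) (∑-split g (suc i) a b) ⟩
  g i + (∑ g (suc i) a + ∑ g (suc i + a) b) ≡⟨ cong (λ z → g i + (∑ g (suc i) a + ∑ g z b)) (sym (+-suc i a)) ⟩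
  g i + (∑ g (suc i) a + ∑ g (i + suc a) b) ≡⟨ sym (+-assoc (g i) _ _) ⟩
  g i + ∑ g (suc i) a + ∑ g (i + suc a) b   ∎
  where open ≡-Reasoning

∑-last : ∀ g i c → ∑ g i (suc c) ≡ ∑ g i c + g (i + c)
∑-last g i c = trans (cong (∑ g i) (+-comm 1 c)) (trans (∑-split g i c 1) (cong (∑ g i c +_) (+-identityʳ _)))

∑-shift : ∀ g i j c → ∑ g (i + j) c ≡ ∑ (λ x → g (x + j)) i c
∑-shift g i j zero = refl
∑-shift g i j (suc c) = cong (g (i + j) +_) (∑-shift g (suc i) j c)

∑-+ : ∀ f g i c → ∑ (λ x → f x + g x) i c ≡ ∑ f i c + ∑ g i c
∑-+ f g i zero = refl
∑-+ f g i (suc c) = trans (cong (f i + g i +_) (∑-+ f g (suc i) c)) (+-interchange (f i) (g i) _ _)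

∑-double : ∀ g i c → ∑ (λ x → g x + g x) i c ≡ 2 * ∑ g i c
∑-double g i c = trans (∑-+ g g i c) (cong (∑ g i c +_) (sym (+-identityʳ _)))

∑-reverse : ∀ g i c → ∑ g i c ≡ ∑ (λ x → g (i + i + c ∸ suc x)) i c
∑-reverse g i zero = refl
∑-reverse g i (suc c) = begin
    ∑ g i (suc c)
  ≡⟨ ∑-last g i c ⟩
    ∑ g i c + g (i + c)
  ≡⟨ cong (_+ g (i + c)) (∑-reverse g i c) ⟩
    ∑ (λ x → g (i + i + c ∸ suc x)) i c + g (i + c)
  ≡⟨ +-comm _ (g (i + c)) ⟩
    g (i + c) + ∑ (λ x → g (i + i + c ∸ suc x)) i c
  ≡⟨ cong₂ _+_ (cong g first) (sym (trans (∑-shift _ i 1 c) (∑-cong i c (λ x _ _ → cong g (rest x))))) ⟩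
    g (i + i + suc c ∸ suc i) + ∑ (λ x → g (i + i + suc c ∸ suc x)) (i + 1) c
  ≡⟨ cong (λ z → g (i + i + suc c ∸ suc i) + ∑ (λ x → g (i + i + suc c ∸ suc x)) z c) (+-comm i 1) ⟩
    ∑ (λ x → g (i + i + suc c ∸ suc x)) i (suc c)
  ∎
  where
  open ≡-Reasoning
  first : i + c ≡ i + i + suc c ∸ suc i
  first = sym (trans (cong (_∸ suc i) (+-suc (i + i) c)) (trans (cong (_∸ i) (+-assoc i i c)) (m+n∸m≡n i (i + c))))
  rest : ∀ x → i + i + suc c ∸ suc (x + 1) ≡ i + i + c ∸ suc x
  rest x = trans (cong (λ z → i + i + suc c ∸ suc z) (+-comm x 1)) (cong (_∸ suc (suc x)) (+-suc (i + i) c))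

∑-fold : ∀ g c d → ∑ g 1 (c + d + c) ≡ ∑ g (1 + c) d + ∑ (λ a → g a + g (c + c + d + 1 ∸ a)) 1 c
∑-fold g c d = begin
    ∑ g 1 (c + d + c)
  ≡⟨ ∑-split g 1 (c + d) c ⟩
    ∑ g 1 (c + d) + ∑ g (1 + (c + d)) c
  ≡⟨ cong₂ _+_ (∑-split g 1 c d) upper ⟩
    ∑ g 1 c + ∑ g (1 + c) d + ∑ (λ a → g (c + c + d + 1 ∸ a)) 1 c
  ≡⟨ trans (cong (_+ ∑ (λ a → g (c + c + d + 1 ∸ a)) 1 c) (+-comm (∑ g 1 c) (∑ g (1 + c) d))) (+-assoc (∑ g (1 + c) d) (∑ g 1 c) _) ⟩
    ∑ g (1 + c) d + (∑ g 1 c + ∑ (λ a → g (c + c + d + 1 ∸ a)) 1 c)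
  ≡⟨ cong (∑ g (1 + c) d +_) (sym (∑-+ g _ 1 c)) ⟩
    ∑ g (1 + c) d + ∑ (λ a → g a + g (c + c + d + 1 ∸ a)) 1 c
  ∎
  where
  open ≡-Reasoning
  j = c + d
  reindex : ∀ c d → 1 + (c + d) + (1 + (c + d)) + c ≡ c + c + d + 1 + suc (c + d)
  reindex = solve-∀
  upper : ∑ g (1 + j) c ≡ ∑ (λ a → g (c + c + d + 1 ∸ a)) 1 c
  upper = begin
      ∑ g (1 + j) c
    ≡⟨ ∑-reverse g (1 + j) c ⟩
      ∑ (λ x → g (1 + j + (1 + j) + c ∸ suc x)) (1 + j) c
    ≡⟨ ∑-shift _ 1 j c ⟩
      ∑ (λ x → g (1 + j + (1 + j) + c ∸ suc (x + j))) 1 c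
    ≡⟨ ∑-cong 1 c (λ x _ _ → cong g (trans (cong₂ _∸_ (reindex c d) (trans (cong suc (+-comm x j)) (+-comm (suc j) x)))
                                        ([m+o]∸[n+o]≡m∸n (c + c + d + 1) x (suc j)))) ⟩
      ∑ (λ a → g (c + c + d + 1 ∸ a)) 1 c
    ∎

term≤∑ : ∀ g i c a → i ≤ a → a < i + c → g a ≤ ∑ g i c
term≤∑ g i zero a i≤a a< = ⊥-elim (n≮n a (<-≤-trans (subst (a <_) (+-identityʳ i) a<) i≤a))
term≤∑ g i (suc c) a i≤a a< with m≤n⇒m<n∨m≡n i≤a
... | inj₂ refl = m≤m+n (g a) _
... | inj₁ i<a = ≤-trans (term≤∑ g (suc i) c a i<a (subst (a <_) (+-suc i c) a<)) (m≤n+m _ (g i))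

two-terms≤∑ : ∀ g i c a b → i ≤ a → a < i + c → i ≤ b → b < i + c → a ≢ b → g a + g b ≤ ∑ g i c
two-terms≤∑ g i zero a b i≤a a< _ _ _ = ⊥-elim (n≮n a (<-≤-trans (subst (a <_) (+-identityʳ i) a<) i≤a))
two-terms≤∑ g i (suc c) a b i≤a a< i≤b b< a≢b with m≤n⇒m<n∨m≡n i≤a | m≤n⇒m<n∨m≡n i≤b
... | inj₂ refl | inj₂ refl = ⊥-elim (a≢b refl)
... | inj₂ refl | inj₁ i<b = +-monoʳ-≤ (g a) (term≤∑ g (suc i) c b i<b (subst (b <_) (+-suc i c) b<))
... | inj₁ i<a | inj₂ refl = subst (_≤ ∑ g i (suc c)) (+-comm (g b) (g a))
        (+-monoʳ-≤ (g b) (term≤∑ g (suc i) c a i<a (subst (a <_) (+-suc i c) a<)))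
... | inj₁ i<a | inj₁ i<b = ≤-trans (two-terms≤∑ g (suc i) c a b i<a (subst (a <_) (+-suc i c) a<) i<b (subst (b <_) (+-suc i c) b<) a≢b)
        (m≤n+m _ (g i))

double-∑-id : ∀ j → 2 * ∑ (λ a → a) 1 j ≡ j * suc j
double-∑-id zero = refl
double-∑-id (suc j) = begin
  2 * ∑ (λ a → a) 1 (suc j)        ≡⟨ cong (2 *_) (∑-last (λ a → a) 1 j) ⟩
  2 * (∑ (λ a → a) 1 j + suc j)    ≡⟨ *-distribˡ-+ 2 (∑ (λ a → a) 1 j) (suc j) ⟩
  2 * ∑ (λ a → a) 1 j + 2 * suc j  ≡⟨ cong (_+ 2 * suc j) (double-∑-id j) ⟩
  j * suc j + 2 * suc j            ≡⟨ step j ⟩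
  suc j * suc (suc j)              ∎
  where
  open ≡-Reasoning
  step : ∀ j → j * suc j + 2 * suc j ≡ suc j * suc (suc j)
  step = solve-∀

increasing⇒allPairs : ∀ {l} → Increasing l → AllPairs _<_ l
increasing⇒allPairs = Linked⇒AllPairs <-trans

allPairs-ext : ∀ {l l′} → AllPairs _<_ l → AllPairs _<_ l′ →
  (∀ x → x ∈ l → x ∈ l′) → (∀ x → x ∈ l′ → x ∈ l) → l ≡ l′
allPairs-ext {[]} {[]} _ _ _ _ = refl
allPairs-ext {[]} {y ∷ _} _ _ _ l′⊆l with () ← l′⊆l y (here refl)
allPairs-ext {x ∷ _} {[]} _ _ l⊆l′ _ with () ← l⊆l′ x (here refl)
allPairs-ext {x ∷ xs} {y ∷ ys} (x< ∷ xs<) (y< ∷ ys<) l⊆l′ l′⊆l = cong₂ _∷_ x≡y (allPairs-ext xs< ys< tail⊆ tail⊇)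
  where
  x≡y : x ≡ y
  x≡y with l⊆l′ x (here refl) | l′⊆l y (here refl)
  ... | here e | _ = e
  ... | there _ | here e = sym e
  ... | there x∈ | there y∈ = ⊥-elim (<-asym (All.lookup y< x∈) (All.lookup x< y∈))
  tail⊆ : ∀ z → z ∈ xs → z ∈ ys
  tail⊆ z z∈ with l⊆l′ z (there z∈)
  ... | there z∈′ = z∈′
  ... | here refl = ⊥-elim (<-irrefl x≡y (All.lookup x< z∈))
  tail⊇ : ∀ z → z ∈ ys → z ∈ xs
  tail⊇ z z∈ with l′⊆l z (there z∈)
  ... | there z∈′ = z∈′
  ... | here refl = ⊥-elim (<-irrefl (sym x≡y) (All.lookup y< z∈))

increasing-ext : ∀ {l l′} → Increasing l → Increasing l′ →
  (∀ x → x ∈ l → x ∈ l′) → (∀ x → x ∈ l′ → x ∈ l) → l ≡ l′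
increasing-ext l< l′< = allPairs-ext (increasing⇒allPairs l<) (increasing⇒allPairs l′<)

∈⇒≤largest : ∀ {x} l → x ∈ l → x ≤ largest l
∈⇒≤largest (y ∷ ys) (here refl) = m≤m⊔n y (largest ys)
∈⇒≤largest (y ∷ ys) (there x∈) = ≤-trans (∈⇒≤largest ys x∈) (m≤n⊔m y (largest ys))

largest-∈ : ∀ y ys → largest (y ∷ ys) ∈ (y ∷ ys)
largest-∈ y [] = here (⊔-identityʳ y)
largest-∈ y (z ∷ zs) with ⊔-sel y (largest (z ∷ zs))
... | inj₁ e = here e
... | inj₂ e = there (subst (_∈ (z ∷ zs)) (sym e) (largest-∈ z zs))

largest-select : ∀ p m → p m ≡ true → largest (select p 1 m) ≡ m
largest-select p zero _ = refl
largest-select p (suc m) pm = ≤-antisym (≤-pred (proj₁ (proj₂ (∈-select⁻ p 1 (suc m) _ (largest∈ _ m∈)))))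
                                         (∈⇒≤largest _ m∈)
  where
  m∈ : suc m ∈ select p 1 (suc m)
  m∈ = ∈-select⁺ p 1 (suc m) (suc m) (s≤s z≤n) ≤-refl pm
  largest∈ : ∀ l → suc m ∈ l → largest l ∈ l
  largest∈ (y ∷ ys) _ = largest-∈ y ys

select-mem : ∀ B c → Increasing B → All (1 ≤_) B → All (_≤ c) B → select (λ b → mem b B) 1 c ≡ B
select-mem B c B< B≥1 B≤c = increasing-ext (select-increasing _ 1 c) B< sel⊆B B⊆sel
  where
  sel⊆B : ∀ x → x ∈ select (λ b → mem b B) 1 c → x ∈ B
  sel⊆B x x∈ = mem≡true⇒∈ x B (proj₂ (proj₂ (∈-select⁻ _ 1 c x x∈)))
  B⊆sel : ∀ x → x ∈ B → x ∈ select (λ b → mem b B) 1 c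
  B⊆sel x x∈ = ∈-select⁺ _ 1 c x (All.lookup B≥1 x∈) (s≤s (All.lookup B≤c x∈)) (∈⇒mem≡true x B x∈)

∈⇒≤sum : ∀ {u} B → u ∈ B → u ≤ sum B
∈⇒≤sum (x ∷ xs) (here refl) = m≤m+n x _
∈⇒≤sum (x ∷ xs) (there u∈) = ≤-trans (∈⇒≤sum xs u∈) (m≤n+m _ x)

two∈⇒≤sum : ∀ {u v} B → u ∈ B → v ∈ B → u ≢ v → u + v ≤ sum B
two∈⇒≤sum (x ∷ xs) (here refl) (here refl) u≢v = ⊥-elim (u≢v refl)
two∈⇒≤sum (x ∷ xs) (here refl) (there v∈) _ = +-monoʳ-≤ x (∈⇒≤sum xs v∈)
two∈⇒≤sum {u} {v} (x ∷ xs) (there u∈) (here refl) _ = subst (_≤ x + sum xs) (+-comm v u) (+-monoʳ-≤ x (∈⇒≤sum xs u∈))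
two∈⇒≤sum (x ∷ xs) (there u∈) (there v∈) u≢v = ≤-trans (two∈⇒≤sum xs u∈ v∈ u≢v) (m≤n+m _ x)

three∈⇒≤sum : ∀ {u v w} B → u ∈ B → v ∈ B → w ∈ B → u ≢ v → u ≢ w → v ≢ w → u + v + w ≤ sum B
three∈⇒≤sum (x ∷ xs) (here refl) (here refl) _ u≢v _ _ = ⊥-elim (u≢v refl)
three∈⇒≤sum (x ∷ xs) (here refl) _ (here refl) _ u≢w _ = ⊥-elim (u≢w refl)
three∈⇒≤sum (x ∷ xs) _ (here refl) (here refl) _ _ v≢w = ⊥-elim (v≢w refl)
three∈⇒≤sum (x ∷ xs) (here refl) (there v∈) (there w∈) _ _ v≢w =
  subst (_≤ x + sum xs) (sym (+-assoc x _ _)) (+-monoʳ-≤ x (two∈⇒≤sum xs v∈ w∈ v≢w))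
three∈⇒≤sum {u} {v} {w} (x ∷ xs) (there u∈) (here refl) (there w∈) _ u≢w _ =
  subst (_≤ x + sum xs) (middle u x w) (+-monoʳ-≤ x (two∈⇒≤sum xs u∈ w∈ u≢w))
  where middle : ∀ u x w → x + (u + w) ≡ u + x + w
        middle = solve-∀
three∈⇒≤sum {u} {v} {w} (x ∷ xs) (there u∈) (there v∈) (here refl) u≢v _ _ =
  subst (_≤ x + sum xs) (last u v x) (+-monoʳ-≤ x (two∈⇒≤sum xs u∈ v∈ u≢v))
  where last : ∀ u v x → x + (u + v) ≡ u + v + x
        last = solve-∀
three∈⇒≤sum (x ∷ xs) (there u∈) (there v∈) (there w∈) u≢v u≢w v≢w =
  ≤-trans (three∈⇒≤sum xs u∈ v∈ w∈ u≢v u≢w v≢w) (m≤n+m _ x)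

∈⇒<sum : ∀ {u} B → 2 ≤ length B → Increasing B → All (1 ≤_) B → u ∈ B → u < sum B
∈⇒<sum (x ∷ []) (s≤s ()) _ _ _
∈⇒<sum {u} (x ∷ y ∷ r) _ (x<y ∷ _) (x≥1 ∷ y≥1 ∷ _) u∈ with u ≟ x
... | yes refl = ≤-trans (subst (_≤ u + y) (+-comm u 1) (+-monoʳ-≤ u y≥1))
                         (two∈⇒≤sum (x ∷ y ∷ r) u∈ (there (here refl)) (λ u≡y → <-irrefl u≡y x<y))
... | no u≢x = ≤-trans (subst (_≤ u + x) (+-comm u 1) (+-monoʳ-≤ u x≥1)) (two∈⇒≤sum (x ∷ y ∷ r) u∈ (here refl) u≢x)

two∈⇒2≤length : ∀ {x y : ℕ} l → x ∈ l → y ∈ l → x ≢ y → 2 ≤ length l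
two∈⇒2≤length (a ∷ []) (here refl) (here refl) x≢y = ⊥-elim (x≢y refl)
two∈⇒2≤length (a ∷ b ∷ r) _ _ _ = s≤s (s≤s z≤n)

sum≡0⇒[] : ∀ L → All (1 ≤_) L → sum L ≡ 0 → L ≡ []
sum≡0⇒[] [] _ _ = refl
sum≡0⇒[] (x ∷ L) (x≥1 ∷ _) e = ⊥-elim (n≮n 0 (<-≤-trans x≥1 (≤-reflexive (m+n≡0⇒m≡0 x e))))

-- The sum of a partition in terms of its pairs {a, m − a}

PairCovered : List ℕ → Set
PairCovered l = ∀ a → 1 ≤ a → a + a < largest l → (mem a l ∨ mem (largest l ∸ a) l) ≡ true

Complementary : (ℕ → Bool) → ℕ → ℕ → Set
Complementary p m c = ∀ a → 1 ≤ a → a ≤ c → p a ≡ not (p (m ∸ a))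

RefinablePattern : (ℕ → Bool) → ℕ → Set
RefinablePattern q M = Σ ℕ λ μ → Σ ℕ λ μ′ →
  1 ≤ μ × μ < μ′ × μ + μ′ ≤ M × q μ ≡ false × q μ′ ≡ false × q (μ + μ′) ≡ true

refinable⇒refinablePattern : ∀ q M → q M ≡ true → Refinable (select q 1 M) → RefinablePattern q M
refinable⇒refinablePattern q M qM (μ , μ′ , (μ≥1 , μ≤ , μ∉) , (μ′≥1 , μ′≤ , μ′∉) , μ<μ′ , μ+μ′∈) =
  μ , μ′ , μ≥1 , μ<μ′ , ≤-pred (proj₁ (proj₂ sum∈)) , missing μ≥1 μ≤ μ∉ , missing μ′≥1 μ′≤ μ′∉ , proj₂ (proj₂ sum∈)
  where
  sum∈ = ∈-select⁻ q 1 M _ μ+μ′∈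
  missing : ∀ {x} → 1 ≤ x → x ≤ largest (select q 1 M) → x ∉ select q 1 M → q x ≡ false
  missing {x} x≥1 x≤ x∉ with q x in qx
  ... | false = refl
  ... | true = ⊥-elim (x∉ (∈-select⁺ q 1 M x x≥1 (s≤s (subst (x ≤_) (largest-select q M qM) x≤)) qx))

module DistinctPartition {N : ℕ} {l : List ℕ} (dp : IsDistinctPartition N l) where
  m : ℕ
  m = largest l

  p : ℕ → Bool
  p x = mem x l

  m∈l : m ∈ l
  m∈l = largest∈ l (proj₂ (proj₂ (proj₂ dp)))
    where
    largest∈ : ∀ l → 2 ≤ length l → largest l ∈ l
    largest∈ (y ∷ ys) _ = largest-∈ y ys

  p-m : p m ≡ true
  p-m = ∈⇒mem≡true m l m∈l

  l≡select : l ≡ select p 1 m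
  l≡select = increasing-ext (proj₁ dp) (select-increasing p 1 m) l⊆ l⊇
    where
    l⊆ : ∀ x → x ∈ l → x ∈ select p 1 m
    l⊆ x x∈ = ∈-select⁺ p 1 m x (All.lookup (proj₁ (proj₂ dp)) x∈) (s≤s (∈⇒≤largest l x∈)) (∈⇒mem≡true x l x∈)
    l⊇ : ∀ x → x ∈ select p 1 m → x ∈ l
    l⊇ x x∈ = mem≡true⇒∈ x l (proj₂ (proj₂ (∈-select⁻ p 1 m x x∈)))

  sum≡∑ : N ≡ ∑ (λ x → when (p x) x) 1 m
  sum≡∑ = trans (sym (proj₁ (proj₂ (proj₂ dp)))) (trans (cong sum l≡select) (sum-select p 1 m))

unrefinable⇒pairCovered : ∀ {N l} → IsUnrefinable N l → PairCovered l
unrefinable⇒pairCovered {l = l} (dp , unref) a a≥1 2a<m with mem a l in a? | mem (largest l ∸ a) l in m-a?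
... | true | _ = refl
... | false | true = refl
... | false | false = ⊥-elim (unref (a , m ∸ a , (a≥1 , a≤m , mem≡false⇒∉ a l a?) ,
        (≤-trans a≥1 (<⇒≤ a<m-a) , m∸n≤m m a , mem≡false⇒∉ (m ∸ a) l m-a?) , a<m-a ,
        subst (_∈ l) (sym (m+[n∸m]≡n a≤m)) m∈l))
  where
  open DistinctPartition dp
  a≤m : a ≤ m
  a≤m = ≤-trans (m≤m+n a a) (<⇒≤ 2a<m)
  a<m-a : a < m ∸ a
  a<m-a = +-cancelˡ-< a a (m ∸ a) (subst (a + a <_) (sym (m+[n∸m]≡n a≤m)) 2a<m)

excess : Bool → Bool → ℕ → ℕ → ℕ
excess true false a b = 0
excess false true a b = b ∸ a
excess true true a b = b
excess false false a b = 0

pair≡+excess : ∀ b₁ b₂ a b → a ≤ b → (b₁ ∨ b₂) ≡ true → when b₁ a + when b₂ b ≡ a + excess b₁ b₂ a b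
pair≡+excess true false a b _ _ = refl
pair≡+excess false true a b a≤b _ = sym (m+[n∸m]≡n a≤b)
pair≡+excess true true a b _ _ = refl

module PairTerms (p : ℕ → Bool) where
  χ : ℕ → ℕ
  χ x = when (p x) x

  pairTerm : ℕ → ℕ → ℕ
  pairTerm m a = χ a + χ (m ∸ a)

  excessAt : ℕ → ℕ → ℕ
  excessAt m a = excess (p a) (p (m ∸ a)) a (m ∸ a)

  ∑-even : ∀ j → p (suc j + suc j) ≡ true →
    ∑ χ 1 (suc j + suc j) ≡ (suc j + suc j) + χ (suc j) + ∑ (pairTerm (suc j + suc j)) 1 j
  ∑-even j p-m = begin
      ∑ χ 1 (suc j + suc j)
    ≡⟨ cong (∑ χ 1) (cong suc (sym mid)) ⟩
      ∑ χ 1 (suc (j + 1 + j))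
    ≡⟨ ∑-last χ 1 (j + 1 + j) ⟩
      ∑ χ 1 (j + 1 + j) + χ (suc (j + 1 + j))
    ≡⟨ cong₂ _+_ (∑-fold χ j 1) (cong χ (cong suc mid)) ⟩
      (χ (1 + j) + 0) + ∑ (λ a → χ a + χ (j + j + 1 + 1 ∸ a)) 1 j + χ m
    ≡⟨ cong (λ z → z + ∑ (λ a → χ a + χ (j + j + 1 + 1 ∸ a)) 1 j + χ m) (+-identityʳ _) ⟩
      χ (suc j) + ∑ (λ a → χ a + χ (j + j + 1 + 1 ∸ a)) 1 j + χ m
    ≡⟨ cong (λ z → χ (suc j) + z + χ m) (∑-cong 1 j (λ x _ _ → cong (λ z → χ x + χ (z ∸ x)) (outer j))) ⟩
      χ (suc j) + ∑ (pairTerm m) 1 j + χ m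
    ≡⟨ trans (+-comm _ (χ m)) (sym (+-assoc (χ m) _ _)) ⟩
      χ m + χ (suc j) + ∑ (pairTerm m) 1 j
    ≡⟨ cong (λ z → z + χ (suc j) + ∑ (pairTerm m) 1 j) χ-m ⟩
      m + χ (suc j) + ∑ (pairTerm m) 1 j
    ∎
    where
    open ≡-Reasoning
    m = suc j + suc j
    mid : j + 1 + j ≡ j + suc j
    mid = trans (cong (_+ j) (+-comm j 1)) (sym (+-suc j j))
    outer : ∀ j → j + j + 1 + 1 ≡ suc j + suc j
    outer = solve-∀
    χ-m : χ m ≡ m
    χ-m rewrite p-m = refl

  ∑-odd : ∀ k → p (suc (k + k)) ≡ true → ∑ χ 1 (suc (k + k)) ≡ suc (k + k) + ∑ (pairTerm (suc (k + k))) 1 k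
  ∑-odd k p-m = begin
      ∑ χ 1 (suc (k + k))
    ≡⟨ ∑-last χ 1 (k + k) ⟩
      ∑ χ 1 (k + k) + χ (suc (k + k))
    ≡⟨ cong₂ _+_ (trans (cong (∑ χ 1) (cong (_+ k) (sym (+-identityʳ k)))) (∑-fold χ k 0)) χ-m ⟩
      ∑ (λ a → χ a + χ (k + k + 0 + 1 ∸ a)) 1 k + m
    ≡⟨ cong (_+ m) (∑-cong 1 k (λ x _ _ → cong (λ z → χ x + χ (z ∸ x)) (outer k))) ⟩
      ∑ (pairTerm m) 1 k + m
    ≡⟨ +-comm _ m ⟩
      m + ∑ (pairTerm m) 1 k
    ∎
    where
    open ≡-Reasoning
    m = suc (k + k)
    outer : ∀ k → k + k + 0 + 1 ≡ suc (k + k)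
    outer = solve-∀
    χ-m : χ m ≡ m
    χ-m rewrite p-m = refl

  ∑-pairTerm : ∀ m c → (∀ a → 1 ≤ a → a ≤ c → (p a ∨ p (m ∸ a)) ≡ true) → c + c < m →
    ∑ (pairTerm m) 1 c ≡ ∑ (λ a → a) 1 c + ∑ (excessAt m) 1 c
  ∑-pairTerm m c covered 2c<m = trans (∑-cong 1 c split) (∑-+ (λ a → a) (excessAt m) 1 c)
    where
    split : ∀ a → 1 ≤ a → a < 1 + c → pairTerm m a ≡ a + excessAt m a
    split a a≥1 a≤c = pair≡+excess (p a) (p (m ∸ a)) a (m ∸ a) a≤m-a (covered a a≥1 (≤-pred a≤c))
      where
      2a<m : a + a < m
      2a<m = ≤-<-trans (+-mono-≤ (≤-pred a≤c) (≤-pred a≤c)) 2c<m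
      a≤m-a : a ≤ m ∸ a
      a≤m-a = +-cancelˡ-≤ a a (m ∸ a) (subst (a + a ≤_) (sym (m+[n∸m]≡n (≤-trans (m≤m+n a a) (<⇒≤ 2a<m)))) (<⇒≤ 2a<m))

-- For largest part 2k the parts are: 2k itself, possibly k, and one or both of each pair {a, 2k − a}, a < k.
module EvenLargestPart {N : ℕ} {l : List ℕ} (dp : IsDistinctPartition N l) (covered : PairCovered l)
               (j : ℕ) (m≡2k : largest l ≡ suc j + suc j) where
  open DistinctPartition dp public
  open PairTerms p public

  k : ℕ
  k = suc j

  top : ℕ
  top = k + k

  p-top : p top ≡ true
  p-top = subst (λ z → p z ≡ true) m≡2k p-m

  2j<top : j + j < top
  2j<top = s≤s (subst (j + j ≤_) (sym (+-suc j j)) (n≤1+n _))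

  covered-top : ∀ a → 1 ≤ a → a ≤ j → (p a ∨ p (top ∸ a)) ≡ true
  covered-top a a≥1 a≤j = subst (λ z → (p a ∨ p (z ∸ a)) ≡ true) m≡2k
    (covered a a≥1 (subst (a + a <_) (sym m≡2k) (≤-<-trans (+-mono-≤ a≤j a≤j) 2j<top)))

  twice-sum≡ : 2 * N ≡ k * (k + 3) + 2 * (χ k + ∑ (excessAt top) 1 j)
  twice-sum≡ = begin
      2 * N
    ≡⟨ cong (2 *_) (trans sum≡∑ (cong (∑ χ 1) m≡2k)) ⟩
      2 * ∑ χ 1 top
    ≡⟨ cong (2 *_) (∑-even j p-top) ⟩
      2 * (top + χ k + ∑ (pairTerm top) 1 j)
    ≡⟨ cong (λ z → 2 * (top + χ k + z)) (∑-pairTerm top j covered-top 2j<top) ⟩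
      2 * (top + χ k + (∑ (λ a → a) 1 j + ∑ (excessAt top) 1 j))
    ≡⟨ regroup j (χ k) (∑ (λ a → a) 1 j) (∑ (excessAt top) 1 j) ⟩
      2 * ∑ (λ a → a) 1 j + (4 * j + 4) + 2 * (χ k + ∑ (excessAt top) 1 j)
    ≡⟨ cong (λ z → z + (4 * j + 4) + 2 * (χ k + ∑ (excessAt top) 1 j)) (double-∑-id j) ⟩
      j * suc j + (4 * j + 4) + 2 * (χ k + ∑ (excessAt top) 1 j)
    ≡⟨ cong (_+ 2 * (χ k + ∑ (excessAt top) 1 j)) (square j) ⟩
      k * (k + 3) + 2 * (χ k + ∑ (excessAt top) 1 j)
    ∎
    where
    open ≡-Reasoning
    regroup : ∀ j x r s → 2 * (suc j + suc j + x + (r + s)) ≡ 2 * r + (4 * j + 4) + 2 * (x + s)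
    regroup = solve-∀
    square : ∀ j → j * suc j + (4 * j + 4) ≡ suc j * (suc j + 3)
    square = solve-∀

  lower-bound : k * (k + 3) ≤ 2 * N
  lower-bound = subst (k * (k + 3) ≤_) (sym twice-sum≡) (m≤m+n _ _)

  aboveHalf : List ℕ
  aboveHalf = select (λ b → p (k + b)) 1 j

  ∑excess≡ : Complementary p top j → ∑ (excessAt top) 1 j ≡ 2 * sum aboveHalf
  ∑excess≡ compl = begin
      ∑ (excessAt top) 1 j
    ≡⟨ ∑-reverse (excessAt top) 1 j ⟩
      ∑ (λ x → excessAt top (k ∸ x)) 1 j
    ≡⟨ ∑-cong 1 j reflected ⟩
      ∑ (λ x → when (p (k + x)) x + when (p (k + x)) x) 1 j
    ≡⟨ ∑-double (λ x → when (p (k + x)) x) 1 j ⟩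
      2 * ∑ (λ x → when (p (k + x)) x) 1 j
    ≡⟨ cong (2 *_) (sym (sum-select (λ b → p (k + b)) 1 j)) ⟩
      2 * sum aboveHalf
    ∎
    where
    open ≡-Reasoning
    when-double : ∀ b x → when b (x + x) ≡ when b x + when b x
    when-double true x = refl
    when-double false x = refl
    reflected : ∀ x → 1 ≤ x → x < 1 + j → excessAt top (k ∸ x) ≡ when (p (k + x)) x + when (p (k + x)) x
    reflected x x≥1 x≤j = trans step (when-double _ x)
      where
      y = k ∸ x
      x+y : x + y ≡ k
      x+y = m+[n∸m]≡n (<⇒≤ x≤j)
      top-y : top ∸ y ≡ k + x
      top-y = subst (λ k → (k + k) ∸ y ≡ k + x) x+y
                (trans (cong (_∸ y) (+-assoc-swap x y)) (m+n∸n≡m _ y))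
        where +-assoc-swap : ∀ x y → (x + y) + (x + y) ≡ ((x + y) + x) + y
              +-assoc-swap = solve-∀
      k+x-y : (k + x) ∸ y ≡ x + x
      k+x-y = subst (λ k → (k + x) ∸ y ≡ x + x) x+y (trans (cong (_∸ y) (rearrange x y)) (m+n∸n≡m _ y))
        where rearrange : ∀ x y → (x + y) + x ≡ (x + x) + y
              rearrange = solve-∀
      step : excessAt top y ≡ when (p (k + x)) (x + x)
      step with compl y (m<n⇒0<n∸m x≤j) (≤-pred (subst (suc y ≤_) x+y (+-monoˡ-≤ y x≥1)))
      ... | py rewrite top-y | py with p (k + x)
      ...   | true = k+x-y
      ...   | false = refl

  module WithDefect (e : ℕ) (twice-sum≡defect : 2 * N ≡ k * (k + 3) + 2 * e) (e≤k : e ≤ k) where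
    defect≡ : e ≡ χ k + ∑ (excessAt top) 1 j
    defect≡ = *-cancelˡ-≡ e _ 2 (+-cancelˡ-≡ (k * (k + 3)) _ _ (trans (sym twice-sum≡defect) twice-sum≡))

    χk≤defect : χ k ≤ e
    χk≤defect = subst (χ k ≤_) (sym defect≡) (m≤m+n _ _)

    -- Both a and 2k − a present would cost an excess 2k − a > k ≥ e.
    complementary : Complementary p top j
    complementary a a≥1 a≤j with p a in pa | p (top ∸ a) in ptop-a | covered-top a a≥1 a≤j
    ... | true | false | _ = refl
    ... | false | true | _ = refl
    ... | true | true | _ = ⊥-elim (n≮n _ (≤-<-trans (≤-trans ∑excess≤e e≤k) (<-≤-trans k<top-a excess≤∑)))
      where
      ∑excess≤e : ∑ (excessAt top) 1 j ≤ e
      ∑excess≤e = subst (∑ (excessAt top) 1 j ≤_) (sym defect≡) (m≤n+m _ _)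
      k<top-a : k < top ∸ a
      k<top-a = +-cancelˡ-< a k (top ∸ a) (subst (a + k <_) (sym (m+[n∸m]≡n (≤-trans (≤-trans a≤j (n≤1+n j)) (m≤m+n k k))))
                  (subst (a + k <_) (+-comm k k) (+-monoˡ-< k (s≤s a≤j))))
      excess≤∑ : top ∸ a ≤ ∑ (excessAt top) 1 j
      excess≤∑ = subst (_≤ ∑ (excessAt top) 1 j) (cong₂ (λ u v → excess u v a (top ∸ a)) pa ptop-a)
                   (term≤∑ (excessAt top) 1 j a a≥1 (s≤s a≤j))

    defect≡aboveHalf : e ≡ χ k + 2 * sum aboveHalf
    defect≡aboveHalf = trans defect≡ (cong (χ k +_) (∑excess≡ complementary))

odd : ℕ → ℕ
odd x = x + x ∸ 1

-- For largest part 2k + 1 the parts are 2k + 1 and one or both of each pair {a, 2k + 1 − a}, a ≤ k.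
module OddLargestPart {N : ℕ} {l : List ℕ} (dp : IsDistinctPartition N l) (covered : PairCovered l)
              (k : ℕ) (k≥1 : 1 ≤ k) (m≡2k+1 : largest l ≡ suc (k + k)) where
  open DistinctPartition dp public
  open PairTerms p public

  top : ℕ
  top = suc (k + k)

  p-top : p top ≡ true
  p-top = subst (λ z → p z ≡ true) m≡2k+1 p-m

  covered-top : ∀ a → 1 ≤ a → a ≤ k → (p a ∨ p (top ∸ a)) ≡ true
  covered-top a a≥1 a≤k = subst (λ z → (p a ∨ p (z ∸ a)) ≡ true) m≡2k+1
    (covered a a≥1 (subst (a + a <_) (sym m≡2k+1) (s≤s (+-mono-≤ a≤k a≤k))))

  twice-sum≡ : 2 * N ≡ k * (k + 5) + 2 + 2 * ∑ (excessAt top) 1 k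
  twice-sum≡ = begin
      2 * N
    ≡⟨ cong (2 *_) (trans sum≡∑ (cong (∑ χ 1) m≡2k+1)) ⟩
      2 * ∑ χ 1 top
    ≡⟨ cong (2 *_) (∑-odd k p-top) ⟩
      2 * (top + ∑ (pairTerm top) 1 k)
    ≡⟨ cong (λ z → 2 * (top + z)) (∑-pairTerm top k covered-top ≤-refl) ⟩
      2 * (top + (∑ (λ a → a) 1 k + ∑ (excessAt top) 1 k))
    ≡⟨ regroup k (∑ (λ a → a) 1 k) (∑ (excessAt top) 1 k) ⟩
      2 * ∑ (λ a → a) 1 k + (4 * k + 2) + 2 * ∑ (excessAt top) 1 k
    ≡⟨ cong (λ z → z + (4 * k + 2) + 2 * ∑ (excessAt top) 1 k) (double-∑-id k) ⟩
      k * suc k + (4 * k + 2) + 2 * ∑ (excessAt top) 1 k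
    ≡⟨ cong (_+ 2 * ∑ (excessAt top) 1 k) (square k) ⟩
      k * (k + 5) + 2 + 2 * ∑ (excessAt top) 1 k
    ∎
    where
    open ≡-Reasoning
    regroup : ∀ k r s → 2 * (suc (k + k) + (r + s)) ≡ 2 * r + (4 * k + 2) + 2 * s
    regroup = solve-∀
    square : ∀ k → k * suc k + (4 * k + 2) ≡ k * (k + 5) + 2
    square = solve-∀

  lower-bound : k * (k + 5) + 2 ≤ 2 * N
  lower-bound = subst (k * (k + 5) + 2 ≤_) (sym twice-sum≡) (m≤m+n _ _)

  oddAboveHalf : List ℕ
  oddAboveHalf = map odd (select (λ x → p (k + x)) 1 k)

  ∑excess≡ : Complementary p top k → ∑ (excessAt top) 1 k ≡ sum oddAboveHalf
  ∑excess≡ compl = begin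
      ∑ (excessAt top) 1 k
    ≡⟨ ∑-reverse (excessAt top) 1 k ⟩
      ∑ (λ x → excessAt top (suc k ∸ x)) 1 k
    ≡⟨ ∑-cong 1 k reflected ⟩
      ∑ (λ x → when (p (k + x)) (odd x)) 1 k
    ≡⟨ sym (sum-map-select (λ x → p (k + x)) odd 1 k) ⟩
      sum oddAboveHalf
    ∎
    where
    open ≡-Reasoning
    reflected : ∀ x → 1 ≤ x → x < 1 + k → excessAt top (suc k ∸ x) ≡ when (p (k + x)) (odd x)
    reflected x x≥1 x≤k = step
      where
      y = suc k ∸ x
      x+y : x + y ≡ suc k
      x+y = m+[n∸m]≡n (<⇒≤ x≤k)
      top-y : top ∸ y ≡ k + x
      top-y = trans (cong (_∸ y) (trans (swap₁ k) (trans (cong (_+ k) (sym x+y)) (swap₂ x y k)))) (m+n∸n≡m (k + x) y)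
        where swap₁ : ∀ k → suc (k + k) ≡ suc k + k
              swap₁ = solve-∀
              swap₂ : ∀ x y k → (x + y) + k ≡ (k + x) + y
              swap₂ = solve-∀
      k+x-y : (k + x) ∸ y ≡ odd x
      k+x-y = ∸-cancel (k + x) (x + x) y (trans (swap₁ k x) (trans (cong (x +_) (sym x+y)) (swap₂ x y)))
        where swap₁ : ∀ k x → (k + x) + 1 ≡ x + suc k
              swap₁ = solve-∀
              swap₂ : ∀ x y → x + (x + y) ≡ (x + x) + y
              swap₂ = solve-∀
      step : excessAt top y ≡ when (p (k + x)) (odd x)
      step with compl y (m<n⇒0<n∸m x≤k) (≤-pred (subst (suc y ≤_) x+y (+-monoˡ-≤ y x≥1)))
      ... | py rewrite top-y | py with p (k + x)
      ...   | true = k+x-y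
      ...   | false = refl

  data OddShape (e : ℕ) : Set where
    exclusive : Complementary p top k → e ≡ sum oddAboveHalf → OddShape e
    doubled : e ≡ suc k → p k ≡ true → p (suc k) ≡ true →
              (∀ a → 1 ≤ a → a < k → p a ≡ true × p (top ∸ a) ≡ false) → OddShape e

  module WithDefect (e : ℕ) (twice-sum≡defect : 2 * N ≡ k * (k + 5) + 2 + 2 * e) (e≤k+1 : e ≤ suc k) where
    defect≡ : e ≡ ∑ (excessAt top) 1 k
    defect≡ = *-cancelˡ-≡ e _ 2 (+-cancelˡ-≡ (k * (k + 5) + 2) _ _ (trans (sym twice-sum≡defect) twice-sum≡))

    excess≤defect : ∀ a → 1 ≤ a → a ≤ k → excessAt top a ≤ e
    excess≤defect a a≥1 a≤k = subst (excessAt top a ≤_) (sym defect≡) (term≤∑ (excessAt top) 1 k a a≥1 (s≤s a≤k))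

    a<top-a : ∀ a → a ≤ k → a < top ∸ a
    a<top-a a a≤k = +-cancelˡ-< a a _ (subst (a + a <_) (sym (m+[n∸m]≡n (≤-trans a≤k (≤-trans (m≤m+n k k) (n≤1+n _)))))
                                        (s≤s (+-mono-≤ a≤k a≤k)))

    top-k : top ∸ k ≡ suc k
    top-k = trans (cong (_∸ k) (sym (+-suc k k))) (m+n∸m≡n k (suc k))

    not-both : ∀ a → 1 ≤ a → a < k → p a ≡ true → p (top ∸ a) ≡ true → ⊥
    not-both a a≥1 a<k pa ptop-a = n≮n _ (<-≤-trans (≤-<-trans e≤k+1 k+2≤top-a) top-a≤e)
      where
      k+2≤top-a : suc (suc k) ≤ top ∸ a
      k+2≤top-a = m+n≤o⇒m≤o∸n (suc (suc k)) (s≤s (subst (_≤ k + k) (+-suc k a) (+-monoʳ-≤ k a<k)))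
      top-a≤e : top ∸ a ≤ e
      top-a≤e = subst (_≤ e) (cong₂ (λ u v → excess u v a (top ∸ a)) pa ptop-a) (excess≤defect a a≥1 (<⇒≤ a<k))

    exclusive-pairs : ¬ (p k ≡ true × p (suc k) ≡ true) → Complementary p top k
    exclusive-pairs not-k-k+1 a a≥1 a≤k with p a in pa | p (top ∸ a) in ptop-a | covered-top a a≥1 a≤k
    ... | true | false | _ = refl
    ... | false | true | _ = refl
    ... | true | true | _ with m≤n⇒m<n∨m≡n a≤k
    ...   | inj₁ a<k = ⊥-elim (not-both a a≥1 a<k pa ptop-a)
    ...   | inj₂ refl = ⊥-elim (not-k-k+1 (pa , subst (λ z → p z ≡ true) top-k ptop-a))

    -- With k and k + 1 present the pair at k alone has excess k + 1 ≥ e, so every other pair has none.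
    doubled-pairs : p k ≡ true → p (suc k) ≡ true → OddShape e
    doubled-pairs pk pk+1 = doubled e≡k+1 pk pk+1 below
      where
      excess-k : excessAt top k ≡ suc k
      excess-k rewrite top-k | pk | pk+1 = refl
      e≡k+1 : e ≡ suc k
      e≡k+1 = ≤-antisym e≤k+1 (subst (_≤ e) excess-k (excess≤defect k k≥1 ≤-refl))
      below : ∀ a → 1 ≤ a → a < k → p a ≡ true × p (top ∸ a) ≡ false
      below a a≥1 a<k with p a in pa | p (top ∸ a) in ptop-a | covered-top a a≥1 (<⇒≤ a<k)
      ... | true | false | _ = refl , refl
      ... | true | true | _ = ⊥-elim (not-both a a≥1 a<k pa ptop-a)
      ... | false | true | _ = ⊥-elim (n≮n 0 (<-≤-trans excess>0 (≤-reflexive excess≡0)))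
        where
        two≤e : suc k + excessAt top a ≤ suc k
        two≤e = subst₂ (λ u v → u + excessAt top a ≤ v) excess-k (trans (sym defect≡) e≡k+1)
                  (two-terms≤∑ (excessAt top) 1 k k a k≥1 ≤-refl a≥1 (s≤s (<⇒≤ a<k)) (λ k≡a → <-irrefl (sym k≡a) a<k))
        excess≡0 : excessAt top a ≡ 0
        excess≡0 = n≤0⇒n≡0 (+-cancelˡ-≤ (suc k) _ 0 (subst (suc k + excessAt top a ≤_) (sym (+-identityʳ (suc k))) two≤e))
        excess>0 : 0 < excessAt top a
        excess>0 rewrite pa | ptop-a = m<n⇒0<n∸m (a<top-a a (<⇒≤ a<k))

    shape : OddShape e
    shape with p k in pk | p (suc k) in pk+1
    ... | true | true = doubled-pairs pk pk+1
    ... | true | false = exclusive compl (trans defect≡ (∑excess≡ compl))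
      where compl = exclusive-pairs (λ (_ , pk+1′) → true≢false (trans (sym pk+1′) pk+1))
    ... | false | _ = exclusive compl (trans defect≡ (∑excess≡ compl))
      where compl = exclusive-pairs (λ (pk′ , _) → true≢false (trans (sym pk′) pk))

-- The candidate partitions

-- config z B has largest part 2k: below k exactly the k − b, b ∈ B, are missing, k is a part iff z,
-- the parts strictly between k and 2k are the k + b, b ∈ B.
module EvenConfig (k : ℕ) where
  inConfig : Bool → List ℕ → ℕ → Bool
  inConfig z B x with x <? k
  ... | yes _ = not (mem (k ∸ x) B)
  ... | no _ with x ≟ k
  ...   | yes _ = z
  ...   | no _ with x <? k + k
  ...     | yes _ = mem (x ∸ k) B
  ...     | no _ = true

  config : Bool → List ℕ → List ℕ
  config z B = select (inConfig z B) 1 (k + k)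

  inConfig-below : ∀ z B x → x < k → inConfig z B x ≡ not (mem (k ∸ x) B)
  inConfig-below z B x x<k with x <? k
  ... | yes _ = refl
  ... | no x≮k = ⊥-elim (x≮k x<k)

  inConfig-k : ∀ z B → inConfig z B k ≡ z
  inConfig-k z B with k <? k
  ... | yes k<k = ⊥-elim (n≮n k k<k)
  ... | no _ with k ≟ k
  ...   | yes _ = refl
  ...   | no k≢k = ⊥-elim (k≢k refl)

  inConfig-above : ∀ z B x → k < x → x < k + k → inConfig z B x ≡ mem (x ∸ k) B
  inConfig-above z B x k<x x<2k with x <? k
  ... | yes x<k = ⊥-elim (<-asym x<k k<x)
  ... | no _ with x ≟ k
  ...   | yes refl = ⊥-elim (n≮n x k<x)
  ...   | no _ with x <? k + k
  ...     | yes _ = refl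
  ...     | no x≮2k = ⊥-elim (x≮2k x<2k)

  inConfig-top : ∀ z B → 1 ≤ k → inConfig z B (k + k) ≡ true
  inConfig-top z B k≥1 with (k + k) <? k
  ... | yes 2k<k = ⊥-elim (n≮n k (≤-<-trans (m≤m+n k k) 2k<k))
  ... | no _ with (k + k) ≟ k
  ...   | yes 2k≡k = ⊥-elim (n≮n k (subst (k <_) 2k≡k (subst (_< k + k) (+-identityʳ k) (+-monoʳ-< k k≥1))))
  ...   | no _ with (k + k) <? k + k
  ...     | yes 2k<2k = ⊥-elim (n≮n _ 2k<2k)
  ...     | no _ = refl

  data MissingIn (B : List ℕ) (x : ℕ) : Set where
    below : ∀ u → u ∈ B → u + x ≡ k → MissingIn B x
    centre : x ≡ k → MissingIn B x
    above : (∀ t → k + t ≡ x → t ∉ B) → k < x → MissingIn B x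

  missingIn : ∀ z B x → x < k + k → inConfig z B x ≡ false → MissingIn B x
  missingIn z B x x<2k x∉ with <-cmp x k
  ... | tri< x<k _ _ = below (k ∸ x) (mem≡true⇒∈ _ B (not≡false⇒≡true _ (trans (sym (inConfig-below z B x x<k)) x∉)))
                             (m∸n+n≡m (<⇒≤ x<k))
  ... | tri≈ _ x≡k _ = centre x≡k
  ... | tri> _ _ k<x = above t∉B k<x
    where
    t∉B : ∀ t → k + t ≡ x → t ∉ B
    t∉B t k+t≡x t∈B = true≢false (trans (sym (∈⇒mem≡true t B t∈B))
      (trans (cong (λ z → mem z B) (sym (trans (cong (_∸ k) (sym k+t≡x)) (m+n∸m≡n k t)))) (trans (sym (inConfig-above z B x k<x x<2k)) x∉)))

  data PresentIn (z : Bool) (B : List ℕ) (s : ℕ) : Set where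
    below : s < k → (∀ u → u + s ≡ k → u ∉ B) → PresentIn z B s
    centre : s ≡ k → z ≡ true → PresentIn z B s
    above : ∀ t → t ∈ B → k + t ≡ s → k < s → PresentIn z B s
    atTop : s ≡ k + k → PresentIn z B s

  presentIn : ∀ z B s → s ≤ k + k → inConfig z B s ≡ true → PresentIn z B s
  presentIn z B s s≤2k s∈ with <-cmp s k
  ... | tri< s<k _ _ = below s<k u∉B
    where
    u∉B : ∀ u → u + s ≡ k → u ∉ B
    u∉B u u+s≡k u∈B = true≢false (trans (sym (∈⇒mem≡true u B u∈B))
      (trans (cong (λ w → mem w B) (sym (trans (cong (_∸ s) (sym u+s≡k)) (m+n∸n≡m u s))))
             (not≡true⇒≡false _ (trans (sym (inConfig-below z B s s<k)) s∈))))
  ... | tri≈ _ refl _ = centre refl (trans (sym (inConfig-k z B)) s∈)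
  ... | tri> _ _ k<s with m≤n⇒m<n∨m≡n s≤2k
  ...   | inj₂ s≡2k = atTop s≡2k
  ...   | inj₁ s<2k = above (s ∸ k) (mem≡true⇒∈ _ B (trans (sym (inConfig-above z B s k<s s<2k)) s∈)) (m+[n∸m]≡n (<⇒≤ k<s)) k<s

  unrefinable-k : 1 ≤ k → ¬ RefinablePattern (inConfig true []) (k + k)
  unrefinable-k k≥1 (μ , μ′ , μ≥1 , μ<μ′ , μ+μ′≤2k , μ∉ , μ′∉ , _) = go (missingIn true [] μ μ<2k μ∉) (missingIn true [] μ′ μ′<2k μ′∉)
    where
    μ′<2k : μ′ < k + k
    μ′<2k = <-≤-trans (subst (μ′ <_) (+-comm μ′ μ) (m<m+n μ′ μ≥1)) μ+μ′≤2k
    μ<2k : μ < k + k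
    μ<2k = <-trans μ<μ′ μ′<2k
    go : MissingIn [] μ → MissingIn [] μ′ → ⊥
    go (centre refl) _ = true≢false (trans (sym (inConfig-k true [])) μ∉)
    go _ (centre refl) = true≢false (trans (sym (inConfig-k true [])) μ′∉)
    go (above _ k<μ) (above _ k<μ′) = n≮n _ (<-≤-trans (+-mono-< k<μ k<μ′) μ+μ′≤2k)

-- not-half excludes B = [k/2]: there k/2 and k are missing while k/2 + k is a part.
module EvenConfigUnrefinable (k : ℕ) (B : List ℕ) (B< : Increasing B) (B≥1 : All (1 ≤_) B)
                             (2ΣB≤k : 2 * sum B ≤ k) (not-half : 2 ≤ length B ⊎ 2 * sum B < k) where
  open EvenConfig k

  ΣB≤k : sum B ≤ k
  ΣB≤k = ≤-trans (m≤m+n (sum B) _) 2ΣB≤k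

  twice≤k : ∀ {x} → x ≤ sum B → 2 * x ≤ k
  twice≤k x≤ΣB = ≤-trans (*-monoʳ-≤ 2 x≤ΣB) 2ΣB≤k

  no-half : ∀ {u} → u ∈ B → u + u ≡ k → ⊥
  no-half {u} u∈B 2u≡k = go not-half
    where
    go : 2 ≤ length B ⊎ 2 * sum B < k → ⊥
    go (inj₁ 2≤|B|) = n≮n _ (<-≤-trans (subst (u + u <_) (sym (2*x≡x+x (suc u))) (+-mono-< ≤-refl ≤-refl))
                            (subst (2 * suc u ≤_) (sym 2u≡k) (twice≤k (∈⇒<sum B 2≤|B| B< B≥1 u∈B))))
    go (inj₂ 2ΣB<k) = n≮n _ (subst (_< k) (trans (2*x≡x+x u) 2u≡k) (≤-<-trans (*-monoʳ-≤ 2 (∈⇒≤sum B u∈B)) 2ΣB<k))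

  module _ {μ μ′ : ℕ} (μ<μ′ : μ < μ′) (μ+μ′≤2k : μ + μ′ ≤ k + k) where
    distinct-complements : ∀ {u u′} → u + μ ≡ k → u′ + μ′ ≡ k → u ≢ u′
    distinct-complements u+μ≡k u′+μ′≡k refl = n≮n _ (subst (μ <_) (+-cancelˡ-≡ _ μ′ μ (trans u′+μ′≡k (sym u+μ≡k))) μ<μ′)

    complements-sum : ∀ u u′ → u + μ ≡ k → u′ + μ′ ≡ k → (u + u′) + (μ + μ′) ≡ k + k
    complements-sum u u′ u+μ≡k u′+μ′≡k = trans (+-interchange u u′ μ μ′) (cong₂ _+_ u+μ≡k u′+μ′≡k)

    sum-not-below : MissingIn B μ → MissingIn B μ′ → μ + μ′ < k → ⊥
    sum-not-below (below u u∈B u+μ≡k) (below u′ u′∈B u′+μ′≡k) μ+μ′<k =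
      n≮n _ (subst (_< k + k) (complements-sum u u′ u+μ≡k u′+μ′≡k)
              (+-mono-≤-< (≤-trans (two∈⇒≤sum B u∈B u′∈B (distinct-complements u+μ≡k u′+μ′≡k)) ΣB≤k) μ+μ′<k))
    sum-not-below (centre refl) _ μ+μ′<k = n≮n _ (<-≤-trans μ+μ′<k (m≤m+n μ μ′))
    sum-not-below (above _ k<μ) _ μ+μ′<k = n≮n _ (<-trans k<μ (≤-<-trans (m≤m+n μ μ′) μ+μ′<k))
    sum-not-below (below _ _ _) (centre refl) μ+μ′<k = n≮n _ (<-≤-trans μ+μ′<k (m≤n+m μ′ μ))
    sum-not-below (below _ _ _) (above _ k<μ′) μ+μ′<k = n≮n _ (<-trans k<μ′ (≤-<-trans (m≤n+m μ′ μ) μ+μ′<k))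

    sum-not-top : MissingIn B μ → MissingIn B μ′ → μ + μ′ ≡ k + k → ⊥
    sum-not-top _ (below u′ u′∈B u′+μ′≡k) μ+μ′≡2k = n≮n _ (subst (_< k + k) μ+μ′≡2k (+-mono-<-≤ (<-trans μ<μ′ μ′<k) (<⇒≤ μ′<k)))
      where
      μ′<k : μ′ < k
      μ′<k = subst (μ′ <_) u′+μ′≡k (m<n+m μ′ (All.lookup B≥1 u′∈B))
    sum-not-top _ (centre refl) μ+μ′≡2k = n≮n _ (subst (_< k + k) μ+μ′≡2k (+-mono-<-≤ μ<μ′ ≤-refl))
    sum-not-top (below u u∈B u+μ≡k) (above t∉B _) μ+μ′≡2k = t∉B u k+u≡μ′ u∈B
      where
      k+u≡μ′ : k + u ≡ μ′
      k+u≡μ′ = +-cancelʳ-≡ μ (k + u) μ′ (trans (+-assoc k u μ) (trans (cong (k +_) u+μ≡k) (trans (sym μ+μ′≡2k) (+-comm μ μ′))))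
    sum-not-top (centre refl) (above _ k<μ′) μ+μ′≡2k = n≮n _ (subst (k + k <_) μ+μ′≡2k (+-monoʳ-< k k<μ′))
    sum-not-top (above _ k<μ) (above _ k<μ′) μ+μ′≡2k = n≮n _ (subst (k + k <_) μ+μ′≡2k (+-mono-< k<μ k<μ′))

    module _ {t : ℕ} (t∈B : t ∈ B) (k+t≡μ+μ′ : k + t ≡ μ + μ′) where
      sum-not-above-below : MissingIn B μ → ∀ u′ → u′ ∈ B → u′ + μ′ ≡ k → ⊥
      sum-not-above-below (centre refl) u′ u′∈B u′+μ′≡k = n≮n _ (<-trans μ<μ′ (subst (μ′ <_) u′+μ′≡k (m<n+m μ′ (All.lookup B≥1 u′∈B))))
      sum-not-above-below (above _ k<μ) u′ u′∈B u′+μ′≡k =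
        n≮n _ (<-trans k<μ (<-trans μ<μ′ (subst (μ′ <_) u′+μ′≡k (m<n+m μ′ (All.lookup B≥1 u′∈B)))))
      sum-not-above-below (below u u∈B u+μ≡k) u′ u′∈B u′+μ′≡k = by-cases (t ≟ u) (t ≟ u′)
        where
        u≢u′ = distinct-complements u+μ≡k u′+μ′≡k
        u+u′+t≡k : u + u′ + t ≡ k
        u+u′+t≡k = +-cancelʳ-≡ k _ k (trans (shuffle u u′ t k) (trans (cong ((u + u′) +_) k+t≡μ+μ′) (complements-sum u u′ u+μ≡k u′+μ′≡k)))
          where shuffle : ∀ u u′ t k → u + u′ + t + k ≡ (u + u′) + (k + t)
                shuffle = solve-∀
        2[u+u′]≤k : (u + u′) + (u + u′) ≤ k
        2[u+u′]≤k = subst (_≤ k) (2*x≡x+x (u + u′)) (twice≤k (two∈⇒≤sum B u∈B u′∈B u≢u′))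
        reorder₁ : ∀ u u′ → (u + u′) + (u + u′) ≡ u + u′ + u + u′
        reorder₁ = solve-∀
        reorder₂ : ∀ u u′ → (u + u′) + (u + u′) ≡ u + u′ + u′ + u
        reorder₂ = solve-∀
        by-cases : Dec (t ≡ u) → Dec (t ≡ u′) → ⊥
        by-cases (yes refl) _ = n≮n _ (<-≤-trans (m<m+n (u + u′ + u) (All.lookup B≥1 u′∈B)) (subst₂ _≤_ (reorder₁ u u′) (sym u+u′+t≡k) 2[u+u′]≤k))
        by-cases (no _) (yes refl) = n≮n _ (<-≤-trans (m<m+n (u + u′ + u′) (All.lookup B≥1 u∈B)) (subst₂ _≤_ (reorder₂ u u′) (sym u+u′+t≡k) 2[u+u′]≤k))
        by-cases (no t≢u) (no t≢u′) = 2*x≰x (u + u′ + t) (≤-trans (All.lookup B≥1 u∈B) (≤-trans (m≤m+n u u′) (m≤m+n _ t)))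
          (subst (2 * (u + u′ + t) ≤_) (sym u+u′+t≡k)
            (twice≤k (three∈⇒≤sum B u∈B u′∈B t∈B u≢u′ (λ u≡t → t≢u (sym u≡t)) (λ u′≡t → t≢u′ (sym u′≡t)))))

      sum-not-above-centre : MissingIn B μ → μ′ ≡ k → ⊥
      sum-not-above-centre (centre μ≡k) μ′≡k = n≮n _ (subst (μ <_) (trans μ′≡k (sym μ≡k)) μ<μ′)
      sum-not-above-centre (above _ k<μ) μ′≡k = n≮n _ (<-trans k<μ (subst (μ <_) μ′≡k μ<μ′))
      sum-not-above-centre (below u u∈B u+μ≡k) μ′≡k = by-cases (u ≟ t)
        where
        u+t≡k : u + t ≡ k
        u+t≡k = trans (cong (u +_) (+-cancelˡ-≡ k t μ (trans k+t≡μ+μ′ (trans (cong (μ +_) μ′≡k) (+-comm μ k))))) u+μ≡k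
        by-cases : Dec (u ≡ t) → ⊥
        by-cases (no u≢t) = 2*x≰x (u + t) (≤-trans (All.lookup B≥1 u∈B) (m≤m+n u t))
                              (subst (2 * (u + t) ≤_) (sym u+t≡k) (twice≤k (two∈⇒≤sum B u∈B t∈B u≢t)))
        by-cases (yes refl) = no-half u∈B u+t≡k

      sum-not-above-above : MissingIn B μ → k < μ′ → ⊥
      sum-not-above-above (centre μ≡k) _ = n≮n _ (<-≤-trans (+-mono-≤-< (≤-reflexive (sym μ≡k)) (≤-<-trans (≤-reflexive (sym μ≡k)) μ<μ′)) μ+μ′≤2k)
      sum-not-above-above (above _ k<μ) _ = n≮n _ (<-≤-trans (+-mono-≤-< (<⇒≤ k<μ) (<-trans k<μ μ<μ′)) μ+μ′≤2k)
      sum-not-above-above (below u u∈B u+μ≡k) k<μ′ = by-cases (u ≟ t)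
        where
        u+t≡μ′ : u + t ≡ μ′
        u+t≡μ′ = +-cancelˡ-≡ k _ _ (trans (shuffle k u t) (trans (cong (u +_) k+t≡μ+μ′) (trans (sym (+-assoc u μ μ′)) (cong (_+ μ′) u+μ≡k))))
          where shuffle : ∀ k u t → k + (u + t) ≡ u + (k + t)
                shuffle = solve-∀
        by-cases : Dec (u ≡ t) → ⊥
        by-cases (no u≢t) = n≮n _ (<-≤-trans k<μ′ (subst (_≤ k) u+t≡μ′ (≤-trans (two∈⇒≤sum B u∈B t∈B u≢t) ΣB≤k)))
        by-cases (yes refl) = n≮n _ (<-≤-trans k<μ′ (subst (_≤ k) (trans (2*x≡x+x u) u+t≡μ′) (twice≤k (∈⇒≤sum B u∈B))))

  unrefinable : ¬ RefinablePattern (inConfig false B) (k + k)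
  unrefinable (μ , μ′ , μ≥1 , μ<μ′ , μ+μ′≤2k , μ∉ , μ′∉ , μ+μ′∈) =
    by-sum (presentIn false B (μ + μ′) μ+μ′≤2k μ+μ′∈) (missingIn false B μ (<-trans μ<μ′ μ′<2k) μ∉) (missingIn false B μ′ μ′<2k μ′∉)
    where
    μ′<2k : μ′ < k + k
    μ′<2k = <-≤-trans (subst (μ′ <_) (+-comm μ′ μ) (m<m+n μ′ μ≥1)) μ+μ′≤2k
    by-sum : PresentIn false B (μ + μ′) → MissingIn B μ → MissingIn B μ′ → ⊥
    by-sum (below μ+μ′<k _) μ-missing μ′-missing = sum-not-below μ<μ′ μ+μ′≤2k μ-missing μ′-missing μ+μ′<k
    by-sum (atTop μ+μ′≡2k) μ-missing μ′-missing = sum-not-top μ<μ′ μ+μ′≤2k μ-missing μ′-missing μ+μ′≡2k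
    by-sum (above t t∈B k+t≡μ+μ′ _) μ-missing (below u′ u′∈B u′+μ′≡k) =
      sum-not-above-below μ<μ′ μ+μ′≤2k t∈B k+t≡μ+μ′ μ-missing u′ u′∈B u′+μ′≡k
    by-sum (above t t∈B k+t≡μ+μ′ _) μ-missing (centre μ′≡k) = sum-not-above-centre μ<μ′ μ+μ′≤2k t∈B k+t≡μ+μ′ μ-missing μ′≡k
    by-sum (above t t∈B k+t≡μ+μ′ _) μ-missing (above _ k<μ′) = sum-not-above-above μ<μ′ μ+μ′≤2k t∈B k+t≡μ+μ′ μ-missing k<μ′

odd+1 : ∀ y → 1 ≤ y → odd y + 1 ≡ y + y
odd+1 (suc y) _ = +-comm (y + suc y) 1

odd-below : ∀ k x y → 1 ≤ y → y + x ≡ suc k → odd y + (x + x) ≡ suc (k + k)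
odd-below k x y y≥1 y+x≡k+1 = +-cancelʳ-≡ 1 _ _ (begin
  odd y + (x + x) + 1   ≡⟨ swap (odd y) x ⟩
  (odd y + 1) + (x + x) ≡⟨ cong (_+ (x + x)) (odd+1 y y≥1) ⟩
  (y + y) + (x + x)     ≡⟨ +-interchange y y x x ⟩
  (y + x) + (y + x)     ≡⟨ cong₂ _+_ y+x≡k+1 y+x≡k+1 ⟩
  suc k + suc k         ≡⟨ cong suc (trans (+-suc k k) (+-comm 1 (k + k))) ⟩
  suc (k + k) + 1       ∎)
  where
  open ≡-Reasoning
  swap : ∀ o x → o + (x + x) + 1 ≡ (o + 1) + (x + x)
  swap = solve-∀

odd-above : ∀ k x y → 1 ≤ y → k + y ≡ x → odd y + suc (k + k) ≡ x + x
odd-above k x y y≥1 k+y≡x = begin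
  odd y + suc (k + k)   ≡⟨ swap (odd y) k ⟩
  (odd y + 1) + (k + k) ≡⟨ cong (_+ (k + k)) (odd+1 y y≥1) ⟩
  (y + y) + (k + k)     ≡⟨ swap′ y k ⟩
  (k + y) + (k + y)     ≡⟨ cong₂ _+_ k+y≡x k+y≡x ⟩
  x + x                 ∎
  where
  open ≡-Reasoning
  swap : ∀ o k → o + suc (k + k) ≡ (o + 1) + (k + k)
  swap = solve-∀
  swap′ : ∀ y k → (y + y) + (k + k) ≡ (k + y) + (k + y)
  swap′ = solve-∀

-- config w B has largest part 2k + 1: x ≤ k is a part iff 2(k + 1 − x) − 1 ∉ B, and k < x < 2k + 1
-- is a part iff 2(x − k) − 1 ∈ B; with w, k + 1 is a part as well.
module OddConfig (k : ℕ) where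
  top : ℕ
  top = suc (k + k)

  inConfig : Bool → List ℕ → ℕ → Bool
  inConfig w B x with x <? suc k
  ... | yes _ = not (mem (odd (suc k ∸ x)) B)
  ... | no _ with x <? top
  ...   | yes _ = mem (odd (x ∸ k)) B ∨ (w ∧ (x ≡ᵇ suc k))
  ...   | no _ = true

  config : Bool → List ℕ → List ℕ
  config w B = select (inConfig w B) 1 top

  inConfig-below : ∀ w B x → x ≤ k → inConfig w B x ≡ not (mem (odd (suc k ∸ x)) B)
  inConfig-below w B x x≤k with x <? suc k
  ... | yes _ = refl
  ... | no x≰k = ⊥-elim (x≰k (s≤s x≤k))

  inConfig-above : ∀ w B x → k < x → x < top → inConfig w B x ≡ (mem (odd (x ∸ k)) B ∨ (w ∧ (x ≡ᵇ suc k)))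
  inConfig-above w B x k<x x<top with x <? suc k
  ... | yes x≤k = ⊥-elim (n≮n _ (<-≤-trans k<x (≤-pred x≤k)))
  ... | no _ with x <? top
  ...   | yes _ = refl
  ...   | no x≮top = ⊥-elim (x≮top x<top)

  inConfig-top : ∀ w B → inConfig w B top ≡ true
  inConfig-top w B with top <? suc k
  ... | yes top≤k = ⊥-elim (n≮n _ (<-≤-trans top≤k (s≤s (m≤m+n k k))))
  ... | no _ with top <? top
  ...   | yes top<top = ⊥-elim (n≮n _ top<top)
  ...   | no _ = refl

  data MissingIn (B : List ℕ) (x : ℕ) : Set where
    below : ∀ u → u ∈ B → u + (x + x) ≡ top → x ≤ k → MissingIn B x
    above : (∀ v → v + top ≡ x + x → v ∉ B) → k < x → MissingIn B x

  missingIn : ∀ B x → x < top → inConfig false B x ≡ false → MissingIn B x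
  missingIn B x x<top x∉ with x ≤? k
  ... | yes x≤k = below (odd y) (mem≡true⇒∈ _ B (not≡false⇒≡true _ (trans (sym (inConfig-below false B x x≤k)) x∉)))
                        (odd-below k x y (m<n⇒0<n∸m (s≤s x≤k)) (m∸n+n≡m (<⇒≤ (s≤s x≤k)))) x≤k
    where y = suc k ∸ x
  ... | no x≰k = above v∉B k<x
    where
    k<x = ≰⇒> x≰k
    y = x ∸ k
    v∉B : ∀ v → v + top ≡ x + x → v ∉ B
    v∉B v v+top≡2x v∈B = true≢false (trans (sym (∈⇒mem≡true v B v∈B)) (trans (cong (λ z → mem z B) v≡odd)
                           (trans (sym (∨-identityʳ _)) (trans (sym (inConfig-above false B x k<x x<top)) x∉))))
      where
      v≡odd : v ≡ odd y
      v≡odd = +-cancelʳ-≡ top v (odd y) (trans v+top≡2x (sym (odd-above k x y (m<n⇒0<n∸m k<x) (m+[n∸m]≡n (<⇒≤ k<x)))))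

  data PresentIn (B : List ℕ) (s : ℕ) : Set where
    below : s ≤ k → (∀ u → u + (s + s) ≡ top → u ∉ B) → PresentIn B s
    above : ∀ v → v ∈ B → v + top ≡ s + s → k < s → PresentIn B s
    atTop : s ≡ top → PresentIn B s

  presentIn : ∀ B s → s ≤ top → inConfig false B s ≡ true → PresentIn B s
  presentIn B s s≤top s∈ with s ≤? k
  ... | yes s≤k = below s≤k u∉B
    where
    y = suc k ∸ s
    u∉B : ∀ u → u + (s + s) ≡ top → u ∉ B
    u∉B u u+2s≡top u∈B = true≢false (trans (sym (∈⇒mem≡true u B u∈B)) (trans (cong (λ z → mem z B) u≡odd)
                           (not≡true⇒≡false _ (trans (sym (inConfig-below false B s s≤k)) s∈))))
      where
      u≡odd : u ≡ odd y
      u≡odd = +-cancelʳ-≡ (s + s) u (odd y)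
                (trans u+2s≡top (sym (odd-below k s y (m<n⇒0<n∸m (s≤s s≤k)) (m∸n+n≡m (<⇒≤ (s≤s s≤k))))))
  ... | no s≰k with m≤n⇒m<n∨m≡n s≤top
  ...   | inj₂ s≡top = atTop s≡top
  ...   | inj₁ s<top = above (odd (s ∸ k))
            (mem≡true⇒∈ _ B (trans (sym (∨-identityʳ _)) (trans (sym (inConfig-above false B s (≰⇒> s≰k) s<top)) s∈)))
            (odd-above k s (s ∸ k) (m<n⇒0<n∸m (≰⇒> s≰k)) (m+[n∸m]≡n (<⇒≤ (≰⇒> s≰k)))) (≰⇒> s≰k)

  -- With w every x ≤ k is a part, and k + 1, 2k + 1 are the only parts above k.
  unrefinable-doubled : ¬ RefinablePattern (inConfig true []) top
  unrefinable-doubled (μ , μ′ , μ≥1 , μ<μ′ , μ+μ′≤top , μ∉ , _) with μ ≤? k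
  ... | yes μ≤k = true≢false (trans (sym (inConfig-below true [] μ μ≤k)) μ∉)
  ... | no μ≰k = n≮n _ (<-≤-trans (subst (_≤ μ + μ′) (cong suc (+-suc k k)) (+-mono-≤ (≰⇒> μ≰k) (<-trans (≰⇒> μ≰k) μ<μ′))) μ+μ′≤top)

-- not-edge excludes B = [1, k] with ΣB = k + 1: there (k + 1)/2 and k are missing while their sum is a part.
module OddConfigUnrefinable (k : ℕ) (B : List ℕ) (k≥2 : 2 ≤ k) (B< : Increasing B) (B≥1 : All (1 ≤_) B)
                            (ΣB≤k+1 : sum B ≤ suc k) (parts<ΣB : ∀ {u} → u ∈ B → u < sum B)
                            (not-edge : 1 ∈ B → k ∈ B → sum B ≡ suc k → ⊥) where
  open OddConfig k

  both-above : ∀ {a b} → k < a → k < b → a + b ≤ top → ⊥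
  both-above {a} {b} k<a k<b a+b≤top = n≮n _ (<-≤-trans (subst (_≤ a + b) (cong suc (+-suc k k)) (+-mono-≤ k<a k<b)) a+b≤top)

  edge : ∀ {u u′} → u ∈ B → u′ ∈ B → u + u′ + u ≡ top → u + u′ ≤ sum B → ⊥
  edge {u} {u′} u∈B u′∈B 2u+u′≡top u+u′≤ΣB = not-edge (subst (_∈ B) u′≡1 u′∈B) (subst (_∈ B) u≡k u∈B) ΣB≡k+1
    where
    u+u′≤k+1 : u + u′ ≤ suc k
    u+u′≤k+1 = ≤-trans u+u′≤ΣB ΣB≤k+1
    u≡k : u ≡ k
    u≡k = ≤-antisym (≤-pred (subst (_≤ suc k) (+-comm u 1) (≤-trans (+-monoʳ-≤ u (All.lookup B≥1 u′∈B)) u+u′≤k+1)))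
                    (+-cancelˡ-≤ k k u (≤-pred (subst (_≤ suc k + u) 2u+u′≡top (+-monoˡ-≤ u u+u′≤k+1))))
    u′≡1 : u′ ≡ 1
    u′≡1 = +-cancelˡ-≡ (k + k) u′ 1 (trans (swap k u′) (trans (subst (λ z → z + u′ + z ≡ top) u≡k 2u+u′≡top) (+-comm 1 (k + k))))
      where swap : ∀ k u′ → k + k + u′ ≡ k + u′ + k
            swap = solve-∀
    ΣB≡k+1 : sum B ≡ suc k
    ΣB≡k+1 = ≤-antisym ΣB≤k+1 (subst (_≤ sum B) (trans (cong₂ _+_ u≡k u′≡1) (+-comm k 1)) u+u′≤ΣB)

  module _ {μ μ′ : ℕ} (μ<μ′ : μ < μ′) (μ+μ′≤top : μ + μ′ ≤ top) where
    distinct-complements : ∀ {u u′} → u + (μ + μ) ≡ top → u′ + (μ′ + μ′) ≡ top → u ≢ u′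
    distinct-complements {u} u+2μ≡top u′+2μ′≡top refl =
      n≮n _ (subst (μ + μ <_) (+-cancelˡ-≡ u _ _ (trans u′+2μ′≡top (sym u+2μ≡top))) (+-mono-< μ<μ′ μ<μ′))

    complements-sum : ∀ u u′ → u + (μ + μ) ≡ top → u′ + (μ′ + μ′) ≡ top → (u + u′) + ((μ + μ′) + (μ + μ′)) ≡ top + top
    complements-sum u u′ u+2μ≡top u′+2μ′≡top = trans (regroup u u′ μ μ′) (cong₂ _+_ u+2μ≡top u′+2μ′≡top)
      where regroup : ∀ u u′ m m′ → (u + u′) + ((m + m′) + (m + m′)) ≡ (u + (m + m)) + (u′ + (m′ + m′))
            regroup = solve-∀

    sum-not-below : MissingIn B μ → MissingIn B μ′ → μ + μ′ ≤ k → ⊥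
    sum-not-below (below u u∈B u+2μ≡top _) (below u′ u′∈B u′+2μ′≡top _) μ+μ′≤k =
      n≮n _ (<-≤-trans k+1+2k<2top (subst (_≤ suc k + (k + k)) (complements-sum u u′ u+2μ≡top u′+2μ′≡top)
        (+-mono-≤ (≤-trans (two∈⇒≤sum B u∈B u′∈B (distinct-complements u+2μ≡top u′+2μ′≡top)) ΣB≤k+1) (+-mono-≤ μ+μ′≤k μ+μ′≤k))))
      where
      k+1+2k<2top : suc k + (k + k) < top + top
      k+1+2k<2top = subst (suc k + (k + k) <_) (expand k) (m<m+n (suc k + (k + k)) (s≤s z≤n))
        where expand : ∀ k → (1 + k + (k + k)) + (1 + k) ≡ (1 + (k + k)) + (1 + (k + k))
              expand = solve-∀
    sum-not-below (above _ k<μ) _ μ+μ′≤k = n≮n _ (<-≤-trans k<μ (≤-trans (m≤m+n μ μ′) μ+μ′≤k))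
    sum-not-below (below _ _ _ _) (above _ k<μ′) μ+μ′≤k = n≮n _ (<-≤-trans k<μ′ (≤-trans (m≤n+m μ′ μ) μ+μ′≤k))

    sum-not-top : MissingIn B μ → MissingIn B μ′ → μ + μ′ ≡ top → ⊥
    sum-not-top _ (below _ _ _ μ′≤k) μ+μ′≡top =
      n≮n _ (<-≤-trans (subst (_≤ k + k) μ+μ′≡top (+-mono-≤ (<⇒≤ (<-≤-trans μ<μ′ μ′≤k)) μ′≤k)) ≤-refl)
    sum-not-top (above _ k<μ) (above _ k<μ′) μ+μ′≡top = both-above k<μ k<μ′ μ+μ′≤top
    sum-not-top (below u u∈B u+2μ≡top _) (above v∉B _) μ+μ′≡top = v∉B u u+top≡2μ′ u∈B
      where
      u+top≡2μ′ : u + top ≡ μ′ + μ′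
      u+top≡2μ′ = +-cancelʳ-≡ (μ + μ) _ _ (trans (swap u top μ) (trans (cong (_+ top) u+2μ≡top)
                    (trans (cong (λ z → z + z) (sym μ+μ′≡top)) (swap′ μ μ′))))
        where swap : ∀ u t m → u + t + (m + m) ≡ (u + (m + m)) + t
              swap = solve-∀
              swap′ : ∀ m m′ → (m + m′) + (m + m′) ≡ m′ + m′ + (m + m)
              swap′ = solve-∀

    module _ {v : ℕ} (v∈B : v ∈ B) (v+top≡2[μ+μ′] : v + top ≡ (μ + μ′) + (μ + μ′)) where
      sum-not-above-below : MissingIn B μ → ∀ u′ → u′ ∈ B → u′ + (μ′ + μ′) ≡ top → μ′ ≤ k → ⊥
      sum-not-above-below (above _ k<μ) _ _ _ μ′≤k = n≮n _ (<-≤-trans k<μ (<⇒≤ (<-≤-trans μ<μ′ μ′≤k)))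
      sum-not-above-below (below u u∈B u+2μ≡top _) u′ u′∈B u′+2μ′≡top _ = by-cases (v ≟ u) (v ≟ u′)
        where
        u≢u′ = distinct-complements u+2μ≡top u′+2μ′≡top
        u+u′+v≡top : u + u′ + v ≡ top
        u+u′+v≡top = +-cancelʳ-≡ top _ _ (trans (shuffle u u′ v top)
                       (trans (cong ((u + u′) +_) v+top≡2[μ+μ′]) (complements-sum u u′ u+2μ≡top u′+2μ′≡top)))
          where shuffle : ∀ u u′ v t → u + u′ + v + t ≡ (u + u′) + (v + t)
                shuffle = solve-∀
        swap : ∀ u u′ → u′ + u + u′ ≡ u + u′ + u′
        swap = solve-∀
        by-cases : Dec (v ≡ u) → Dec (v ≡ u′) → ⊥
        by-cases (yes refl) _ = edge u∈B u′∈B u+u′+v≡top (two∈⇒≤sum B u∈B u′∈B u≢u′)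
        by-cases (no _) (yes refl) = edge u′∈B u∈B (trans (swap u u′) u+u′+v≡top) (two∈⇒≤sum B u′∈B u∈B (λ u′≡u → u≢u′ (sym u′≡u)))
        by-cases (no v≢u) (no v≢u′) = n≮n _ (<-≤-trans (m<m+n k (≤-trans (s≤s z≤n) k≥2))
          (≤-pred (subst (_≤ suc k) u+u′+v≡top
            (≤-trans (three∈⇒≤sum B u∈B u′∈B v∈B u≢u′ (λ u≡v → v≢u (sym u≡v)) (λ u′≡v → v≢u′ (sym u′≡v))) ΣB≤k+1))))

      sum-not-above-above : MissingIn B μ → k < μ′ → ⊥
      sum-not-above-above (above _ k<μ) k<μ′ = both-above k<μ k<μ′ μ+μ′≤top
      sum-not-above-above (below u u∈B u+2μ≡top _) k<μ′ = by-cases (u ≟ v)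
        where
        u+v≡2μ′ : u + v ≡ μ′ + μ′
        u+v≡2μ′ = +-cancelʳ-≡ top _ _ (trans (+-assoc u v top) (trans (cong (u +_) v+top≡2[μ+μ′])
                    (trans (regroup u μ μ′) (trans (cong (_+ (μ′ + μ′)) u+2μ≡top) (+-comm top _)))))
          where regroup : ∀ u m m′ → u + ((m + m′) + (m + m′)) ≡ (u + (m + m)) + (m′ + m′)
                regroup = solve-∀
        2[k+1]≤u+v : suc k + suc k ≤ u + v
        2[k+1]≤u+v = subst (suc k + suc k ≤_) (sym u+v≡2μ′) (+-mono-≤ k<μ′ k<μ′)
        by-cases : Dec (u ≡ v) → ⊥
        by-cases (no u≢v) = n≮n _ (<-≤-trans (<-≤-trans (m<m+n (suc k) (s≤s z≤n)) 2[k+1]≤u+v)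
                                              (≤-trans (two∈⇒≤sum B u∈B v∈B u≢v) ΣB≤k+1))
        by-cases (yes refl) = n≮n _ (<-≤-trans (<-≤-trans (+-mono-< ≤-refl ≤-refl) 2[k+1]≤u+v) (+-mono-≤ u≤k u≤k))
          where
          u≤k : u ≤ k
          u≤k = ≤-pred (≤-trans (parts<ΣB u∈B) ΣB≤k+1)

  unrefinable : ¬ RefinablePattern (inConfig false B) top
  unrefinable (μ , μ′ , μ≥1 , μ<μ′ , μ+μ′≤top , μ∉ , μ′∉ , μ+μ′∈) =
    by-sum (presentIn B (μ + μ′) μ+μ′≤top μ+μ′∈) (missingIn B μ (<-trans μ<μ′ μ′<top) μ∉) (missingIn B μ′ μ′<top μ′∉)
    where
    μ′<top : μ′ < top
    μ′<top = <-≤-trans (subst (μ′ <_) (+-comm μ′ μ) (m<m+n μ′ μ≥1)) μ+μ′≤top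
    by-sum : PresentIn B (μ + μ′) → MissingIn B μ → MissingIn B μ′ → ⊥
    by-sum (below μ+μ′≤k _) μ-missing μ′-missing = sum-not-below μ<μ′ μ+μ′≤top μ-missing μ′-missing μ+μ′≤k
    by-sum (atTop μ+μ′≡top) μ-missing μ′-missing = sum-not-top μ<μ′ μ+μ′≤top μ-missing μ′-missing μ+μ′≡top
    by-sum (above v v∈B v+top≡2[μ+μ′] _) μ-missing (below u′ u′∈B u′+2μ′≡top μ′≤k) =
      sum-not-above-below μ<μ′ μ+μ′≤top v∈B v+top≡2[μ+μ′] μ-missing u′ u′∈B u′+2μ′≡top μ′≤k
    by-sum (above v v∈B v+top≡2[μ+μ′] _) μ-missing (above _ k<μ′) =
      sum-not-above-above μ<μ′ μ+μ′≤top v∈B v+top≡2[μ+μ′] μ-missing k<μ′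

module ComplementarySelect (q : ℕ → Bool) (m c : ℕ) (q-m : q m ≡ true) (c≥1 : 1 ≤ c) (2c<m : c + c < m)
                           (half : ∀ a → a + a < m → a ≤ c) (compl : Complementary q m c) where
  l : List ℕ
  l = select q 1 m

  mem≡q : ∀ x → 1 ≤ x → x ≤ m → mem x l ≡ q x
  mem≡q x x≥1 x≤m = mem-select q 1 m x x≥1 (s≤s x≤m)

  largest≡ : largest l ≡ m
  largest≡ = largest-select q m q-m

  a<m : ∀ a → a ≤ c → a < m
  a<m a a≤c = ≤-<-trans (≤-trans a≤c (m≤m+n c c)) 2c<m

  mem-complementary : Complementary (λ x → mem x l) m c
  mem-complementary a a≥1 a≤c = trans (mem≡q a a≥1 (<⇒≤ (a<m a a≤c)))
    (trans (compl a a≥1 a≤c) (cong not (sym (mem≡q (m ∸ a) (m<n⇒0<n∸m (a<m a a≤c)) (m∸n≤m m a)))))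

  isDistinctPartition : IsDistinctPartition (sum l) l
  isDistinctPartition = select-increasing q 1 m , select-positive q m , refl , two-parts (mem 1 l) refl
    where
    m∈ : m ∈ l
    m∈ = ∈-select⁺ q 1 m m (≤-trans c≥1 (<⇒≤ (a<m c ≤-refl))) ≤-refl q-m
    two-parts : ∀ b → mem 1 l ≡ b → 2 ≤ length l
    two-parts true 1∈ = two∈⇒2≤length l (mem≡true⇒∈ 1 l 1∈) m∈ (λ 1≡m → <-irrefl 1≡m (a<m 1 c≥1))
    two-parts false 1∉ = two∈⇒2≤length l (mem≡true⇒∈ (m ∸ 1) l (not≡false⇒≡true _ (trans (sym (mem-complementary 1 ≤-refl c≥1)) 1∉))) m∈
                           (λ m-1≡m → <-irrefl m-1≡m (∸-monoʳ-< {n = 1} {o = 0} ≤-refl (<⇒≤ (a<m 1 c≥1))))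

  pairCovered : PairCovered l
  pairCovered a a≥1 2a<l = subst (λ w → (mem a l ∨ mem (w ∸ a) l) ≡ true) (sym largest≡)
    (trans (cong (_∨ mem (m ∸ a) l) (mem-complementary a a≥1 (half a (subst (a + a <_) largest≡ 2a<l)))) (not-b∨b (mem (m ∸ a) l)))
    where
    not-b∨b : ∀ b → (not b ∨ b) ≡ true
    not-b∨b true = refl
    not-b∨b false = refl

module EvenConfigPartition (j : ℕ) (j≥1 : 1 ≤ j) (z : Bool) (B : List ℕ)
                           (B< : Increasing B) (B≥1 : All (1 ≤_) B) (B≤j : All (_≤ j) B) where
  k : ℕ
  k = suc j
  open EvenConfig k

  2j<2k : j + j < k + k
  2j<2k = s≤s (subst (j + j ≤_) (sym (+-suc j j)) (n≤1+n _))

  complementary-pattern : Complementary (inConfig z B) (k + k) j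
  complementary-pattern a a≥1 a≤j = trans (inConfig-below z B a (s≤s a≤j))
    (cong not (sym (trans (inConfig-above z B (k + k ∸ a) k<2k-a 2k-a<2k) (cong (λ w → mem w B) 2k-a-k≡k-a))))
    where
    k<2k-a : k < k + k ∸ a
    k<2k-a = m+n≤o⇒m≤o∸n (suc k) (subst (suc (k + a) ≤_) (sym (+-suc k j)) (s≤s (+-monoʳ-≤ k a≤j)))
    2k-a<2k : k + k ∸ a < k + k
    2k-a<2k = ∸-monoʳ-< {n = a} {o = 0} a≥1 (≤-trans (≤-trans a≤j (n≤1+n j)) (m≤m+n k k))
    2k-a-k≡k-a : (k + k ∸ a) ∸ k ≡ k ∸ a
    2k-a-k≡k-a = trans (cong (_∸ k) (+-∸-assoc k (≤-trans a≤j (n≤1+n j)))) (m+n∸m≡n k (k ∸ a))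

  half : ∀ a → a + a < k + k → a ≤ j
  half a 2a<2k with a ≤? j
  ... | yes a≤j = a≤j
  ... | no a≰j = ⊥-elim (n≮n _ (<-≤-trans 2a<2k (+-mono-≤ (≰⇒> a≰j) (≰⇒> a≰j))))

  open ComplementarySelect (inConfig z B) (k + k) j (inConfig-top z B (s≤s z≤n)) j≥1 2j<2k half complementary-pattern public
  open EvenLargestPart isDistinctPartition pairCovered j largest≡ using (twice-sum≡; ∑excess≡; aboveHalf)

  aboveHalf≡B : aboveHalf ≡ B
  aboveHalf≡B = trans (select-cong 1 j mem-above) (select-mem B j B< B≥1 B≤j)
    where
    mem-above : ∀ b → 1 ≤ b → b < 1 + j → mem (k + b) l ≡ mem b B
    mem-above b b≥1 b≤j = trans (mem≡q (k + b) (≤-trans (s≤s z≤n) (m≤m+n k b)) (+-monoʳ-≤ k (≤-trans (≤-pred b≤j) (n≤1+n j))))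
      (trans (inConfig-above z B (k + b) (m<m+n k b≥1) (+-monoʳ-< k b≤j)) (cong (λ w → mem w B) (m+n∸m≡n k b)))

  mem-k : mem k l ≡ z
  mem-k = trans (mem≡q k (s≤s z≤n) (m≤m+n k k)) (inConfig-k z B)

  twice-sum-config≡ : 2 * sum (config z B) ≡ k * (k + 3) + 2 * (when z k + 2 * sum B)
  twice-sum-config≡ = trans twice-sum≡ (cong (λ w → k * (k + 3) + 2 * w)
    (cong₂ _+_ (cong (λ b → when b k) mem-k) (trans (∑excess≡ mem-complementary) (cong (λ w → 2 * sum w) aboveHalf≡B))))

odd-mono : ∀ {x y} → x < y → odd x < odd y
odd-mono {zero} {suc y} _ = ≤-trans (s≤s z≤n) (m≤n+m (suc y) y)
odd-mono {suc x} {suc y} (s≤s x<y) = +-mono-< x<y (s≤s x<y)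

odd-positive : ∀ {x} → 1 ≤ x → 1 ≤ odd x
odd-positive {suc x} _ = ≤-trans (s≤s z≤n) (m≤n+m (suc x) x)

odd-injective : ∀ {x y} → odd x ≡ odd y → x ≡ y
odd-injective {x} {y} e with <-cmp x y
... | tri< x<y _ _ = ⊥-elim (n≮n _ (subst (_< odd y) e (odd-mono x<y)))
... | tri≈ _ x≡y _ = x≡y
... | tri> _ _ y<x = ⊥-elim (n≮n _ (subst (odd y <_) e (odd-mono y<x)))

odd%2≡1 : ∀ x → 1 ≤ x → odd x % 2 ≡ 1
odd%2≡1 (suc x) _ = trans (cong (_% 2) (rearrange x)) ([m+kn]%n≡m%n 1 x 2)
  where rearrange : ∀ x → x + suc x ≡ 1 + x * 2
        rearrange = solve-∀

odd<2k : ∀ k x → 1 ≤ x → x ≤ k → odd x < k + k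
odd<2k k (suc x) _ x≤k = +-mono-≤ x≤k x≤k

%2≡1⇒odd : ∀ b → b % 2 ≡ 1 → b ≡ odd (suc (b / 2))
%2≡1⇒odd b b%2≡1 = trans (m≡m%n+[m/n]*n b 2) (trans (cong (_+ (b / 2) * 2) b%2≡1) (rearrange (b / 2)))
  where rearrange : ∀ q → 1 + q * 2 ≡ q + suc q
        rearrange = solve-∀

odd<2k⇒≤k : ∀ {y k} → odd y < k + k → y ≤ k
odd<2k⇒≤k {zero} _ = z≤n
odd<2k⇒≤k {suc y} {suc k} odd<2k with y ≤? k
... | yes y≤k = s≤s y≤k
... | no y≰k = ⊥-elim (n≮n _ (<-≤-trans (+-mono-< (≰⇒> y≰k) (≰⇒> y≰k)) (≤-pred (subst₂ _≤_ (+-suc y y) (+-suc k k) (≤-pred odd<2k)))))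

map-odd-increasing : ∀ {L} → Increasing L → Increasing (map odd L)
map-odd-increasing L< = AllPairs⇒Linked (allPairs (increasing⇒allPairs L<))
  where
  above : ∀ {x L} → All (x <_) L → All (odd x <_) (map odd L)
  above [] = []
  above (x<y ∷ x<L) = odd-mono x<y ∷ above x<L
  allPairs : ∀ {L} → AllPairs _<_ L → AllPairs _<_ (map odd L)
  allPairs [] = []
  allPairs (x< ∷ L<) = above x< ∷ allPairs L<

mem-odd-map : ∀ y L → mem (odd y) (map odd L) ≡ mem y L
mem-odd-map y [] = refl
mem-odd-map y (z ∷ L) = cong₂ _∨_ (same-test y z) (mem-odd-map y L)
  where
  same-test : ∀ y z → (odd y ≡ᵇ odd z) ≡ (y ≡ᵇ z)
  same-test y z with y ≟ z
  ... | yes refl = trans (≡ᵇ-refl (odd y)) (sym (≡ᵇ-refl y))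
  ... | no y≢z = trans (≢⇒≡ᵇ-false (odd y) (odd z) (λ e → y≢z (odd-injective e))) (sym (≢⇒≡ᵇ-false y z y≢z))

map-odd-select-mem : ∀ k B → Increasing B → All (λ b → b % 2 ≡ 1) B → All (_< k + k) B →
  map odd (select (λ x → mem (odd x) B) 1 k) ≡ B
map-odd-select-mem k B B< B-odd B<2k = increasing-ext (map-odd-increasing (select-increasing _ 1 k)) B< ⊆B B⊆
  where
  ⊆B : ∀ b → b ∈ map odd (select (λ x → mem (odd x) B) 1 k) → b ∈ B
  ⊆B b b∈ with ∈-map⁻ odd b∈
  ... | x , x∈ , refl = mem≡true⇒∈ (odd x) B (proj₂ (proj₂ (∈-select⁻ _ 1 k x x∈)))
  B⊆ : ∀ b → b ∈ B → b ∈ map odd (select (λ x → mem (odd x) B) 1 k)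
  B⊆ b b∈ = subst (_∈ map odd (select (λ x → mem (odd x) B) 1 k)) (sym b≡)
              (∈-map⁺ odd (∈-select⁺ _ 1 k y (s≤s z≤n) (s≤s (odd<2k⇒≤k (subst (_< k + k) b≡ (All.lookup B<2k b∈))))
                (subst (λ w → mem w B ≡ true) b≡ (∈⇒mem≡true b B b∈))))
    where
    y = suc (b / 2)
    b≡ : b ≡ odd y
    b≡ = %2≡1⇒odd b (All.lookup B-odd b∈)

module OddConfigPartition (k : ℕ) (k≥2 : 2 ≤ k) where
  open OddConfig k

  k≥1 : 1 ≤ k
  k≥1 = ≤-trans (s≤s z≤n) k≥2

  half : ∀ a → a + a < top → a ≤ k
  half a 2a<top with a ≤? k
  ... | yes a≤k = a≤k
  ... | no a≰k = ⊥-elim (n≮n _ (<-≤-trans (+-mono-< ≤-refl ≤-refl) (≤-trans (+-mono-≤ (≰⇒> a≰k) (≰⇒> a≰k)) (≤-pred 2a<top))))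

  top-a≤top : ∀ a → 1 ≤ a → a ≤ k → top ∸ a < top
  top-a≤top a a≥1 a≤k = ∸-monoʳ-< {n = a} {o = 0} a≥1 (≤-trans a≤k (≤-trans (m≤m+n k k) (n≤1+n _)))

  module Exclusive (B : List ℕ) (B< : Increasing B) (B-odd : All (λ b → b % 2 ≡ 1) B) (B<2k : All (_< k + k) B) where
    complementary-pattern : Complementary (inConfig false B) top k
    complementary-pattern a a≥1 a≤k = trans (inConfig-below false B a a≤k)
      (cong not (sym (trans (inConfig-above false B (top ∸ a) k<top-a (top-a≤top a a≥1 a≤k))
        (trans (∨-identityʳ _) (cong (λ w → mem (odd w) B) top-a-k≡k+1-a)))))
      where
      k<top-a : k < top ∸ a
      k<top-a = m+n≤o⇒m≤o∸n (suc k) (s≤s (+-monoʳ-≤ k a≤k))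
      top-a-k≡k+1-a : (top ∸ a) ∸ k ≡ suc k ∸ a
      top-a-k≡k+1-a = trans (cong (_∸ k) (+-∸-comm {suc k} k {a} (≤-trans a≤k (n≤1+n k)))) (m+n∸n≡m (suc k ∸ a) k)

    open ComplementarySelect (inConfig false B) top k (inConfig-top false B) k≥1 ≤-refl half complementary-pattern public
    open OddLargestPart isDistinctPartition pairCovered k k≥1 largest≡ using (twice-sum≡; ∑excess≡; oddAboveHalf)

    oddAboveHalf≡B : oddAboveHalf ≡ B
    oddAboveHalf≡B = trans (cong (map odd) (select-cong 1 k mem-above)) (map-odd-select-mem k B B< B-odd B<2k)
      where
      mem-above : ∀ x → 1 ≤ x → x < 1 + k → mem (k + x) l ≡ mem (odd x) B
      mem-above x x≥1 x≤k = trans (mem≡q (k + x) (≤-trans k≥1 (m≤m+n k x)) (≤-trans (+-monoʳ-≤ k (≤-pred x≤k)) (n≤1+n _)))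
        (trans (inConfig-above false B (k + x) (m<m+n k x≥1) (s≤s (+-monoʳ-≤ k (≤-pred x≤k))))
        (trans (∨-identityʳ _) (cong (λ w → mem (odd w) B) (m+n∸m≡n k x))))

    twice-sum-config≡ : 2 * sum (config false B) ≡ k * (k + 5) + 2 + 2 * sum B
    twice-sum-config≡ = trans twice-sum≡ (cong (λ w → k * (k + 5) + 2 + 2 * w) (trans (∑excess≡ mem-complementary) (cong sum oddAboveHalf≡B)))

  module Doubled where
    l : List ℕ
    l = config true []

    mem≡inConfig : ∀ x → 1 ≤ x → x ≤ top → mem x l ≡ inConfig true [] x
    mem≡inConfig x x≥1 x≤top = mem-select (inConfig true []) 1 top x x≥1 (s≤s x≤top)

    largest≡ : largest l ≡ top
    largest≡ = largest-select (inConfig true []) top (inConfig-top true [])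

    mem-below : ∀ a → 1 ≤ a → a ≤ k → mem a l ≡ true
    mem-below a a≥1 a≤k = trans (mem≡inConfig a a≥1 (≤-trans a≤k (≤-trans (m≤m+n k k) (n≤1+n _)))) (inConfig-below true [] a a≤k)

    mem-k+1 : mem (suc k) l ≡ true
    mem-k+1 = trans (mem≡inConfig (suc k) (s≤s z≤n) (s≤s (m≤m+n k k)))
      (trans (inConfig-above true [] (suc k) ≤-refl (s≤s (subst (_≤ k + k) (+-comm k 1) (+-monoʳ-≤ k k≥1)))) (≡ᵇ-refl (suc k)))

    mem-above : ∀ x → suc k < x → x < top → mem x l ≡ false
    mem-above x k+1<x x<top = trans (mem≡inConfig x (≤-trans (s≤s z≤n) k+1<x) (<⇒≤ x<top))
      (trans (inConfig-above true [] x (<-trans ≤-refl k+1<x) x<top) (≢⇒≡ᵇ-false x (suc k) (λ x≡k+1 → n≮n _ (subst (suc k <_) x≡k+1 k+1<x))))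

    isDistinctPartition : IsDistinctPartition (sum l) l
    isDistinctPartition = select-increasing (inConfig true []) 1 top , select-positive (inConfig true []) top , refl ,
      two∈⇒2≤length l (mem≡true⇒∈ 1 l (mem-below 1 ≤-refl k≥1))
        (∈-select⁺ (inConfig true []) 1 top top (s≤s z≤n) ≤-refl (inConfig-top true [])) (λ 1≡top → <-irrefl 1≡top (s≤s (≤-trans k≥1 (m≤m+n k k))))

    pairCovered : PairCovered l
    pairCovered a a≥1 2a<l rewrite mem-below a a≥1 (half a (subst (a + a <_) largest≡ 2a<l)) = refl

    open OddLargestPart isDistinctPartition pairCovered k k≥1 largest≡ using (twice-sum≡; excessAt)

    ∑excess≡k+1 : ∑ (excessAt top) 1 k ≡ suc k
    ∑excess≡k+1 = trans (split-last k≥1) (cong₂ _+_ none-below excess-k)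
      where
      split-last : ∀ {c} → 1 ≤ c → ∑ (excessAt top) 1 c ≡ ∑ (excessAt top) 1 (c ∸ 1) + excessAt top c
      split-last {suc c} _ = ∑-last (excessAt top) 1 c
      top-k≡k+1 : top ∸ k ≡ suc k
      top-k≡k+1 = trans (cong (_∸ k) (sym (+-suc k k))) (m+n∸m≡n k (suc k))
      excess-k : excessAt top k ≡ suc k
      excess-k rewrite top-k≡k+1 | mem-below k k≥1 ≤-refl | mem-k+1 = refl
      none-below : ∑ (excessAt top) 1 (k ∸ 1) ≡ 0
      none-below = ∑-zero (excessAt top) 1 (k ∸ 1) (λ a a≥1 a< → no-excess a a≥1 (subst (a <_) (m+[n∸m]≡n k≥1) a<))
        where
        no-excess : ∀ a → 1 ≤ a → a < k → excessAt top a ≡ 0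
        no-excess a a≥1 a<k rewrite mem-below a a≥1 (<⇒≤ a<k)
                                  | mem-above (top ∸ a) (m+n≤o⇒m≤o∸n (suc (suc k)) (s≤s (subst (_≤ k + k) (+-suc k a) (+-monoʳ-≤ k a<k))))
                                              (top-a≤top a a≥1 (<⇒≤ a<k)) = refl

    twice-sum-config≡ : 2 * sum l ≡ k * (k + 5) + 2 + 2 * suc k
    twice-sum-config≡ = trans twice-sum≡ (cong (λ w → k * (k + 5) + 2 + 2 * w) ∑excess≡k+1)

-- The largest part of a maximal unrefinable partition

even-lower-bound : ∀ {N l} → IsUnrefinable N l → ∀ j → largest l ≡ suc j + suc j → suc j * (suc j + 3) ≤ 2 * N
even-lower-bound u j m≡ = EvenLargestPart.lower-bound (proj₁ u) (unrefinable⇒pairCovered u) j m≡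

odd-lower-bound : ∀ {N l} → IsUnrefinable N l → ∀ h → 1 ≤ h → largest l ≡ suc (h + h) → h * (h + 5) + 2 ≤ 2 * N
odd-lower-bound u h h≥1 m≡ = OddLargestPart.lower-bound (proj₁ u) (unrefinable⇒pairCovered u) h h≥1 m≡

even-bound-mono : ∀ {a b} → a ≤ b → a * (a + 3) ≤ b * (b + 3)
even-bound-mono a≤b = *-mono-≤ a≤b (+-monoˡ-≤ 3 a≤b)

odd-bound-mono : ∀ {a b} → a ≤ b → a * (a + 5) + 2 ≤ b * (b + 5) + 2
odd-bound-mono a≤b = +-monoˡ-≤ 2 (*-mono-≤ a≤b (+-monoˡ-≤ 5 a≤b))

-- Every unrefinable partition with largest part m has 2N ≥ k(k + 3) for m = 2k and ≥ k(k + 5) + 2 for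
-- m = 2k + 1; these bounds increase with m, so a small defect caps m.
largest≤-even : ∀ {N l} k e → 1 ≤ k → 2 * N ≡ k * (k + 3) + 2 * e → e ≤ k → IsUnrefinable N l → largest l ≤ k + k
largest≤-even {N} {l} k e k≥1 2N≡ e≤k u with largest l ≤? k + k
... | yes m≤2k = m≤2k
... | no m≰2k with even-or-odd (largest l)
...   | inj₁ (zero , m≡0) = ⊥-elim (m≰2k (subst (_≤ k + k) (sym m≡0) z≤n))
...   | inj₁ (suc j , m≡) = ⊥-elim (n≮n _ (<-≤-trans 2N<next (≤-trans (even-bound-mono k<j+1) (even-lower-bound u j m≡))))
  where
  k<j+1 : suc k ≤ suc j
  k<j+1 = s≤s (half-≤ (subst (k + k ≤_) (+-suc j j) (≤-pred (subst (suc (k + k) ≤_) m≡ (≰⇒> m≰2k)))))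
  2N<next : 2 * N < suc k * (suc k + 3)
  2N<next = subst (_< suc k * (suc k + 3)) (sym 2N≡) (≤-<-trans (+-monoʳ-≤ (k * (k + 3)) (*-monoʳ-≤ 2 e≤k))
              (subst (k * (k + 3) + 2 * k <_) (expand k) (m<m+n _ (s≤s z≤n))))
    where expand : ∀ k → k * (k + 3) + 2 * k + 4 ≡ suc k * (suc k + 3)
          expand = solve-∀
...   | inj₂ (h , m≡) = ⊥-elim (n≮n _ (<-≤-trans 2N<next (≤-trans (odd-bound-mono k≤h) (odd-lower-bound u h (≤-trans k≥1 k≤h) m≡))))
  where
  k≤h : k ≤ h
  k≤h = half-≤ (≤-trans (≤-pred (subst (suc (k + k) ≤_) m≡ (≰⇒> m≰2k))) (n≤1+n _))
  2N<next : 2 * N < k * (k + 5) + 2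
  2N<next = subst (_< k * (k + 5) + 2) (sym 2N≡) (≤-<-trans (+-monoʳ-≤ (k * (k + 3)) (*-monoʳ-≤ 2 e≤k))
              (subst (_< k * (k + 5) + 2) (expand k) (m<m+n _ (s≤s z≤n))))
    where expand : ∀ k → k * (k + 5) ≡ k * (k + 3) + 2 * k
          expand = solve-∀

-- Largest part 2k + 2 would give defect 2s − 1 in the even analysis: odd, yet it must be
-- [k + 1 ∈ l](k + 1) plus an even number, and k + 1 > 2s − 1.
largest≢2k+2 : ∀ {N l} k s → 2 * N ≡ k * (k + 5) + 2 + 2 * (s + s) → s + s ≤ suc k → IsUnrefinable N l →
               largest l ≢ suc k + suc k
largest≢2k+2 {N} {l} k zero 2N≡ _ u m≡ = n≮n _ (<-≤-trans (subst (_< suc k * (suc k + 3)) (sym 2N≡) (below k)) (even-lower-bound u k m≡))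
  where below : ∀ k → k * (k + 5) + 2 + 2 * 0 < suc k * (suc k + 3)
        below k = subst (k * (k + 5) + 2 + 2 * 0 <_) (expand k) (m<m+n _ (s≤s z≤n))
          where expand : ∀ k → k * (k + 5) + 2 + 2 * 0 + 2 ≡ suc k * (suc k + 3)
                expand = solve-∀
largest≢2k+2 {N} {l} k (suc s) 2N≡ 2s≤k+1 u m≡ = by-centre (mem (suc k) l) refl
  where
  e = suc (s + s)
  2N≡′ : 2 * N ≡ suc k * (suc k + 3) + 2 * e
  2N≡′ = trans 2N≡ (rearrange k s)
    where rearrange : ∀ k s → k * (k + 5) + 2 + 2 * (suc s + suc s) ≡ suc k * (suc k + 3) + 2 * suc (s + s)
          rearrange = solve-∀
  e<k+1 : suc e ≤ suc k
  e<k+1 = subst (_≤ suc k) (cong suc (+-suc s s)) 2s≤k+1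
  open EvenLargestPart (proj₁ u) (unrefinable⇒pairCovered u) k m≡ using (aboveHalf)
  open EvenLargestPart.WithDefect (proj₁ u) (unrefinable⇒pairCovered u) k m≡ e 2N≡′ (≤-trans (n≤1+n e) e<k+1)
    using (defect≡aboveHalf; χk≤defect)
  by-centre : ∀ b → mem (suc k) l ≡ b → ⊥
  by-centre true k+1∈ = n≮n _ (<-≤-trans e<k+1 (subst (λ w → when w (suc k) ≤ e) k+1∈ χk≤defect))
  by-centre false k+1∉ = even≢odd (sum aboveHalf) s (trans (sym (trans defect≡aboveHalf (cong (λ w → when w (suc k) + 2 * sum aboveHalf) k+1∉)))
                           (cong suc (cong (s +_) (sym (+-identityʳ s)))))

largest≤-odd : ∀ {N l} k s → 1 ≤ k → 2 * N ≡ k * (k + 5) + 2 + 2 * (s + s) → s + s ≤ suc k →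
               IsUnrefinable N l → largest l ≤ suc (k + k)
largest≤-odd {N} {l} k s k≥1 2N≡ 2s≤k+1 u with largest l ≤? suc (k + k)
... | yes m≤2k+1 = m≤2k+1
... | no m≰2k+1 with even-or-odd (largest l)
...   | inj₂ (h , m≡) = ⊥-elim (n≮n _ (<-≤-trans 2N<next (≤-trans (odd-bound-mono k<h) (odd-lower-bound u h (≤-trans (s≤s z≤n) k<h) m≡))))
  where
  k<h : suc k ≤ h
  k<h = half-≤ (subst (_≤ suc (h + h)) (cong suc (sym (+-suc k k))) (subst (suc (suc (k + k)) ≤_) m≡ (≰⇒> m≰2k+1)))
  2N<next : 2 * N < suc k * (suc k + 5) + 2
  2N<next = subst (_< suc k * (suc k + 5) + 2) (sym 2N≡) (≤-<-trans (+-monoʳ-≤ (k * (k + 5) + 2) (*-monoʳ-≤ 2 2s≤k+1))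
              (subst (k * (k + 5) + 2 + 2 * suc k <_) (expand k) (m<m+n _ (s≤s z≤n))))
    where expand : ∀ k → k * (k + 5) + 2 + 2 * suc k + 4 ≡ suc k * (suc k + 5) + 2
          expand = solve-∀
...   | inj₁ (zero , m≡0) = ⊥-elim (m≰2k+1 (subst (_≤ suc (k + k)) (sym m≡0) z≤n))
...   | inj₁ (suc j , m≡) with suc k ≤? j
...     | yes k+1≤j = ⊥-elim (n≮n _ (<-≤-trans 2N<next (≤-trans (even-bound-mono (s≤s k+1≤j)) (even-lower-bound u j m≡))))
  where
  2N<next : 2 * N < suc (suc k) * (suc (suc k) + 3)
  2N<next = subst (_< suc (suc k) * (suc (suc k) + 3)) (sym 2N≡) (≤-<-trans (+-monoʳ-≤ (k * (k + 5) + 2) (*-monoʳ-≤ 2 2s≤k+1))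
              (subst (k * (k + 5) + 2 + 2 * suc k <_) (expand k) (m<m+n _ (s≤s z≤n))))
    where expand : ∀ k → k * (k + 5) + 2 + 2 * suc k + 6 ≡ suc (suc k) * (suc (suc k) + 3)
          expand = solve-∀
...     | no k+1≰j = ⊥-elim (largest≢2k+2 k s 2N≡ 2s≤k+1 u (trans m≡ (cong (λ i → suc i + suc i) j≡k)))
  where
  j≡k : j ≡ k
  j≡k = ≤-antisym (≤-pred (≰⇒> k+1≰j)) (half-≤ (≤-trans (≤-pred (subst (suc (k + k) ≤_) (+-suc j j) (≤-pred (subst (suc (suc (k + k)) ≤_) m≡ (≰⇒> m≰2k+1))))) (n≤1+n _)))

-- Classification and counting

module _ {P Q : List ℕ → Set} (f : List ℕ → List ℕ) (f-maps : ∀ {B} → P B → Q (f B))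
         (f-injective : ∀ {B B′} → P B → P B′ → f B ≡ f B′ → B ≡ B′) where
  unique-map : ∀ {xs} → All P xs → Unique xs → Unique (map f xs)
  unique-map [] [] = []
  unique-map {x ∷ xs} (px ∷ pxs) (x∉xs ∷ xs!) = map⁺ (All.tabulate λ {y} y∈ fx≡fy → All.lookup x∉xs y∈ (f-injective px (All.lookup pxs y∈) fx≡fy))
                                                ∷ unique-map pxs xs!

  hasCard-image : ∀ {c} → HasCard P c → (∀ {l} → Q l → Σ (List ℕ) λ B → P B × l ≡ f B) → HasCard Q c
  hasCard-image (xs , xs! , all-P , complete , |xs|≡c) surjective =
    map f xs , unique-map all-P xs! , map⁺ (All.map f-maps all-P) , covers , trans (length-map f xs) |xs|≡c
    where
    covers : ∀ l → Q l → l ∈ map f xs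
    covers l ql with surjective ql
    ... | B , pB , refl = ∈-map⁺ f (complete B pB)

  hasCard-image+1 : ∀ {c} (w : List ℕ) → HasCard P c → Q w → (∀ {B} → P B → w ≢ f B) →
    (∀ {l} → Q l → l ≡ w ⊎ Σ (List ℕ) λ B → P B × l ≡ f B) → HasCard Q (1 + c)
  hasCard-image+1 w (xs , xs! , all-P , complete , |xs|≡c) qw w∉image covered =
    w ∷ map f xs , map⁺ (All.tabulate λ {B} B∈ → w∉image (All.lookup all-P B∈)) ∷ unique-map all-P xs! ,
    qw ∷ map⁺ (All.map f-maps all-P) , covers , cong suc (trans (length-map f xs) |xs|≡c)
    where
    covers : ∀ l → Q l → l ∈ w ∷ map f xs
    covers l ql with covered ql
    ... | inj₁ refl = here refl
    ... | inj₂ (B , pB , refl) = there (∈-map⁺ f (complete B pB))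

hasCard-single : ∀ {P : List ℕ → Set} w → P w → (∀ l → P l → l ≡ w) → HasCard P 1
hasCard-single w pw unique = (w ∷ []) , ([] ∷ []) , (pw ∷ []) , (λ l pl → here (unique l pl)) , refl

module EvenConfigInjective (j : ℕ) where
  k : ℕ
  k = suc j
  open EvenConfig k

  mem-above-config : ∀ z B b → 1 ≤ b → b ≤ j → mem (k + b) (config z B) ≡ mem b B
  mem-above-config z B b b≥1 b≤j =
    trans (mem-select (inConfig z B) 1 (k + k) (k + b) (≤-trans (s≤s z≤n) (m≤m+n k b)) (s≤s (+-monoʳ-≤ k (≤-trans b≤j (n≤1+n j)))))
          (trans (inConfig-above z B (k + b) (m<m+n k b≥1) (+-monoʳ-< k (s≤s b≤j))) (cong (λ w → mem w B) (m+n∸m≡n k b)))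

  config-injective : ∀ z z′ B B′ → Increasing B → All (1 ≤_) B → All (_≤ j) B →
    Increasing B′ → All (1 ≤_) B′ → All (_≤ j) B′ → config z B ≡ config z′ B′ → B ≡ B′
  config-injective z z′ B B′ B< B≥1 B≤j B′< B′≥1 B′≤j config≡ =
    trans (sym (select-mem B j B< B≥1 B≤j)) (trans (select-cong 1 j same-mem) (select-mem B′ j B′< B′≥1 B′≤j))
    where
    same-mem : ∀ b → 1 ≤ b → b < 1 + j → mem b B ≡ mem b B′
    same-mem b b≥1 b≤j = trans (sym (mem-above-config z B b b≥1 (≤-pred b≤j)))
                           (trans (cong (mem (k + b)) config≡) (mem-above-config z′ B′ b b≥1 (≤-pred b≤j)))

  mem-k-config : ∀ z B → mem k (config z B) ≡ z
  mem-k-config z B = trans (mem-select (inConfig z B) 1 (k + k) k (s≤s z≤n) (s≤s (m≤m+n k k))) (inConfig-k z B)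

module EvenClassification (j : ℕ) (j≥1 : 1 ≤ j) (N e : ℕ) (2N≡ : 2 * N ≡ suc j * (suc j + 3) + 2 * e) (e≤k : e ≤ suc j) where
  k : ℕ
  k = suc j
  open EvenConfig k public
  open EvenConfigInjective j public using (config-injective; mem-k-config)

  largest-config : ∀ z B → largest (config z B) ≡ k + k
  largest-config z B = largest-select (inConfig z B) (k + k) (inConfig-top z B (s≤s z≤n))

  config-unrefinable : ∀ z B → Increasing B → All (1 ≤_) B → All (_≤ j) B →
    e ≡ when z k + 2 * sum B → ¬ RefinablePattern (inConfig z B) (k + k) → IsUnrefinable N (config z B)
  config-unrefinable z B B< B≥1 B≤j e≡ no-pattern =
    subst (λ w → IsDistinctPartition w (config z B)) sum≡N isDistinctPartition ,
    λ refinable → no-pattern (refinable⇒refinablePattern _ _ (inConfig-top z B (s≤s z≤n)) refinable)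
    where
    open EvenConfigPartition j j≥1 z B B< B≥1 B≤j using (twice-sum-config≡; isDistinctPartition)
    sum≡N : sum (config z B) ≡ N
    sum≡N = *-cancelˡ-≡ _ _ 2 (trans twice-sum-config≡ (trans (cong (λ w → k * (k + 3) + 2 * w) (sym e≡)) (sym 2N≡)))

  maximal : ∀ l → IsUnrefinable N l → largest l ≡ k + k → IsMaximalUnrefinable N l
  maximal l u m≡2k = u , λ l′ u′ → subst (largest l′ ≤_) (sym m≡2k) (largest≤-even k e (s≤s z≤n) 2N≡ e≤k u′)

  maximal⇒largest≡ : ∀ w → IsUnrefinable N w → largest w ≡ k + k → ∀ l → IsMaximalUnrefinable N l → largest l ≡ k + k
  maximal⇒largest≡ w uw w≡2k l (u , max) = ≤-antisym (largest≤-even k e (s≤s z≤n) 2N≡ e≤k u) (subst (_≤ largest l) w≡2k (max w uw))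

  data ConfigOf (l : List ℕ) : Set where
    configOf : ∀ z B → Increasing B → All (1 ≤_) B → l ≡ config z B → e ≡ when z k + 2 * sum B → ConfigOf l

  module Classify (l : List ℕ) (u : IsUnrefinable N l) (m≡2k : largest l ≡ k + k) where
    open EvenLargestPart (proj₁ u) (unrefinable⇒pairCovered u) j m≡2k using (p; aboveHalf; p-top; l≡select)
    open EvenLargestPart.WithDefect (proj₁ u) (unrefinable⇒pairCovered u) j m≡2k e 2N≡ e≤k using (defect≡aboveHalf; complementary)

    aboveHalf-increasing : Increasing aboveHalf
    aboveHalf-increasing = select-increasing _ 1 j

    aboveHalf-positive : All (1 ≤_) aboveHalf
    aboveHalf-positive = select-positive _ j

    mem-aboveHalf : ∀ b → 1 ≤ b → b ≤ j → mem b aboveHalf ≡ p (k + b)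
    mem-aboveHalf b b≥1 b≤j = mem-select (λ b → p (k + b)) 1 j b b≥1 (s≤s b≤j)

    p≡inConfig : ∀ x → 1 ≤ x → x < 1 + (k + k) → p x ≡ inConfig (p k) aboveHalf x
    p≡inConfig x x≥1 x≤2k with <-cmp x k
    ... | tri< x<k _ _ = trans (complementary x x≥1 (≤-pred x<k))
        (trans (cong not (trans (cong p (+-∸-assoc k (<⇒≤ x<k)))
                  (sym (mem-aboveHalf (k ∸ x) (m<n⇒0<n∸m x<k) (≤-pred (∸-monoʳ-< {m = k} {n = x} {o = 0} x≥1 (<⇒≤ x<k)))))))
               (sym (inConfig-below (p k) aboveHalf x x<k)))
    ... | tri≈ _ refl _ = sym (inConfig-k (p k) aboveHalf)
    ... | tri> _ _ k<x with m≤n⇒m<n∨m≡n (≤-pred x≤2k)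
    ...   | inj₂ refl = trans p-top (sym (inConfig-top (p k) aboveHalf (s≤s z≤n)))
    ...   | inj₁ x<2k = trans (cong p (sym (m+[n∸m]≡n (<⇒≤ k<x))))
        (trans (sym (mem-aboveHalf (x ∸ k) (m<n⇒0<n∸m k<x) (≤-pred (subst (x ∸ k <_) (m+n∸m≡n k k) (∸-monoˡ-< x<2k (<⇒≤ k<x))))))
               (sym (inConfig-above (p k) aboveHalf x k<x x<2k)))

    l≡config : l ≡ config (p k) aboveHalf
    l≡config = trans l≡select (trans (cong (select p 1) m≡2k) (select-cong 1 (k + k) p≡inConfig))

    configOf-l : ConfigOf l
    configOf-l = configOf (p k) aboveHalf aboveHalf-increasing aboveHalf-positive l≡config defect≡aboveHalf

  classify : ∀ w → IsUnrefinable N w → largest w ≡ k + k → ∀ l → IsMaximalUnrefinable N l → ConfigOf l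
  classify w uw w≡2k l max = Classify.configOf-l l (proj₁ max) (maximal⇒largest≡ w uw w≡2k l max)

module EvenSingle (j : ℕ) (j≥1 : 1 ≤ j) (N : ℕ) where
  defect-zero : 2 * N ≡ suc j * (suc j + 3) + 2 * 0 → HasCard (IsMaximalUnrefinable N) 1
  defect-zero 2N≡ = hasCard-single w (maximal w uw (largest-config false [])) is-w
    where
    open EvenClassification j j≥1 N 0 2N≡ z≤n
    w = config false []
    uw : IsUnrefinable N w
    uw = config-unrefinable false [] [] [] [] refl (EvenConfigUnrefinable.unrefinable (suc j) [] [] [] z≤n (inj₂ (s≤s z≤n)))
    is-w : ∀ l → IsMaximalUnrefinable N l → l ≡ w
    is-w l max = from-config (classify w uw (largest-config false []) l max)
      where
      from-config : ConfigOf l → l ≡ w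
      from-config (configOf true B _ _ _ 0≡) = ⊥-elim (n≮n 0 (≤-trans (s≤s z≤n) (subst (k ≤_) (sym 0≡) (m≤m+n k _))))
      from-config (configOf false B _ B≥1 l≡ 0≡) = trans l≡ (cong (config false) (sum≡0⇒[] B B≥1 (*-cancelˡ-≡ _ 0 2 (sym 0≡))))

  defect-k : (∀ t → suc j ≢ t + t) → 2 * N ≡ suc j * (suc j + 3) + 2 * suc j → HasCard (IsMaximalUnrefinable N) 1
  defect-k k-odd 2N≡ = hasCard-single w (maximal w uw (largest-config true [])) is-w
    where
    open EvenClassification j j≥1 N (suc j) 2N≡ ≤-refl
    w = config true []
    uw : IsUnrefinable N w
    uw = config-unrefinable true [] [] [] [] (sym (+-identityʳ k)) (unrefinable-k (s≤s z≤n))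
    is-w : ∀ l → IsMaximalUnrefinable N l → l ≡ w
    is-w l max = from-config (classify w uw (largest-config true []) l max)
      where
      from-config : ConfigOf l → l ≡ w
      from-config (configOf false B _ _ _ k≡) = ⊥-elim (k-odd (sum B) (trans k≡ (2*x≡x+x (sum B))))
      from-config (configOf true B _ B≥1 l≡ k≡) = trans l≡ (cong (config true)
        (sum≡0⇒[] B B≥1 (*-cancelˡ-≡ _ 0 2 (+-cancelˡ-≡ k _ _ (trans (sym k≡) (sym (+-identityʳ k)))))))

-- For defect 2s with 1 ≤ s and 2s ≤ k, the maximal partitions are config false B for the distinct partitions B
-- of s, plus one more: config false [s] when 2s < k, config true [] when 2s = k (then config false [s] is refinable).
module EvenCount (j : ℕ) (j≥1 : 1 ≤ j) (s : ℕ) (s≥1 : 1 ≤ s) (N : ℕ)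
                 (2N≡ : 2 * N ≡ suc j * (suc j + 3) + 2 * (s + s)) (2s≤k : s + s ≤ suc j) where
  open EvenClassification j j≥1 N (s + s) 2N≡ 2s≤k

  s≤j : s ≤ j
  s≤j = ≤-pred (<-≤-trans (m<m+n s s≥1) 2s≤k)

  2ΣB≡2s : ∀ B → sum B ≡ s → 2 * sum B ≡ s + s
  2ΣB≡2s B ΣB≡s = trans (cong (2 *_) ΣB≡s) (2*x≡x+x s)

  parts≤j : ∀ {B} → sum B ≡ s → All (_≤ j) B
  parts≤j {B} ΣB≡s = All.tabulate λ x∈ → ≤-trans (subst (_ ≤_) ΣB≡s (∈⇒≤sum B x∈)) s≤j

  config-maximal : ∀ {B} → IsDistinctPartition s B → IsMaximalUnrefinable N (config false B)
  config-maximal {B} (B< , B≥1 , ΣB≡s , 2≤|B|) = maximal (config false B)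
    (config-unrefinable false B B< B≥1 (parts≤j ΣB≡s) (sym (2ΣB≡2s B ΣB≡s))
      (EvenConfigUnrefinable.unrefinable k B B< B≥1 (subst (_≤ k) (sym (2ΣB≡2s B ΣB≡s)) 2s≤k) (inj₁ 2≤|B|)))
    (largest-config false B)

  config-injective-on : ∀ {B B′} → IsDistinctPartition s B → IsDistinctPartition s B′ → config false B ≡ config false B′ → B ≡ B′
  config-injective-on (B< , B≥1 , ΣB≡s , _) (B′< , B′≥1 , ΣB′≡s , _) =
    config-injective false false _ _ B< B≥1 (parts≤j ΣB≡s) B′< B′≥1 (parts≤j ΣB′≡s)

  without-k : ∀ l B → Increasing B → All (1 ≤_) B → l ≡ config false B → s + s ≡ 2 * sum B →
              l ≡ config false (s ∷ []) ⊎ Σ (List ℕ) λ B → IsDistinctPartition s B × l ≡ config false B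
  without-k l B B< B≥1 l≡ 2s≡ = by-length B refl
    where
    ΣB≡s : sum B ≡ s
    ΣB≡s = *-cancelˡ-≡ _ _ 2 (sym (trans (2*x≡x+x s) 2s≡))
    by-length : ∀ B′ → B ≡ B′ → l ≡ config false (s ∷ []) ⊎ Σ (List ℕ) λ B → IsDistinctPartition s B × l ≡ config false B
    by-length [] refl = ⊥-elim (n≮n 0 (<-≤-trans s≥1 (≤-reflexive (sym ΣB≡s))))
    by-length (b ∷ []) refl = inj₁ (trans l≡ (cong (λ x → config false (x ∷ [])) (trans (sym (+-identityʳ b)) ΣB≡s)))
    by-length (b ∷ b′ ∷ r) refl = inj₂ (B , (B< , B≥1 , ΣB≡s , s≤s (s≤s z≤n)) , l≡)

  count-with : ∀ w → IsUnrefinable N w → largest w ≡ k + k → (∀ {B} → IsDistinctPartition s B → w ≢ config false B) →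
    (∀ l → IsMaximalUnrefinable N l → mem k l ≡ true → l ≡ w) →
    (∀ l → IsMaximalUnrefinable N l → l ≡ config false (s ∷ []) → l ≡ w) →
    ∀ c → HasCard (IsDistinctPartition s) c → HasCard (IsMaximalUnrefinable N) (1 + c)
  count-with w uw w≡2k w∉image with-k single c #D =
    hasCard-image+1 (config false) config-maximal config-injective-on w #D (maximal w uw w≡2k) w∉image covered
    where
    covered : ∀ {l} → IsMaximalUnrefinable N l → l ≡ w ⊎ Σ (List ℕ) λ B → IsDistinctPartition s B × l ≡ config false B
    covered {l} max = from-config (classify w uw w≡2k l max)
      where
      from-config : ConfigOf l → l ≡ w ⊎ Σ (List ℕ) λ B → IsDistinctPartition s B × l ≡ config false B
      from-config (configOf true B _ _ l≡ _) = inj₁ (with-k l max (trans (cong (mem k) l≡) (mem-k-config true B)))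
      from-config (configOf false B B< B≥1 l≡ 2s≡) = map₁ (single l max) (without-k l B B< B≥1 l≡ 2s≡)

  count-below : s + s < k → ∀ c → HasCard (IsDistinctPartition s) c → HasCard (IsMaximalUnrefinable N) (1 + c)
  count-below 2s<k = count-with w uw (largest-config false (s ∷ [])) w∉image with-k (λ _ _ l≡w → l≡w)
    where
    w = config false (s ∷ [])
    2Σ[s]≡2s : 2 * sum (s ∷ []) ≡ s + s
    2Σ[s]≡2s = 2ΣB≡2s (s ∷ []) (+-identityʳ s)
    uw : IsUnrefinable N w
    uw = config-unrefinable false (s ∷ []) [-] (s≥1 ∷ []) (s≤j ∷ []) (sym 2Σ[s]≡2s)
           (EvenConfigUnrefinable.unrefinable k (s ∷ []) [-] (s≥1 ∷ []) (subst (_≤ k) (sym 2Σ[s]≡2s) 2s≤k)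
             (inj₂ (subst (_< k) (sym 2Σ[s]≡2s) 2s<k)))
    w∉image : ∀ {B} → IsDistinctPartition s B → w ≢ config false B
    w∉image (B< , B≥1 , ΣB≡s , 2≤|B|) w≡ = 2≰1 (subst (λ B → 2 ≤ length B) (sym [s]≡B) 2≤|B|)
      where
      [s]≡B = config-injective false false (s ∷ []) _ [-] (s≥1 ∷ []) (s≤j ∷ []) B< B≥1 (parts≤j ΣB≡s) w≡
      2≰1 : 2 ≤ 1 → ⊥
      2≰1 (s≤s ())
    with-k : ∀ l → IsMaximalUnrefinable N l → mem k l ≡ true → l ≡ w
    with-k l max k∈l = from-config (classify w uw (largest-config false (s ∷ [])) l max)
      where
      from-config : ConfigOf l → l ≡ w
      from-config (configOf z B _ _ l≡ 2s≡) = ⊥-elim (n≮n _ (<-≤-trans 2s<k (subst (k ≤_) (sym 2s≡′) (m≤m+n k _))))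
        where
        z≡true : z ≡ true
        z≡true = trans (sym (mem-k-config z B)) (trans (cong (mem k) (sym l≡)) k∈l)
        2s≡′ : s + s ≡ k + 2 * sum B
        2s≡′ = trans 2s≡ (cong (λ b → when b k + 2 * sum B) z≡true)

  -- With 2s = k, the missing s and k sum to the part k + s of config false [s].
  singleton-refinable : s + s ≡ k → Refinable (config false (s ∷ []))
  singleton-refinable 2s≡k = s , k , (s≥1 , s≤largest , mem≡false⇒∉ s _ s∉) , (s≤s z≤n , subst (k ≤_) (sym largest≡) (m≤m+n k k) , k∉) , s<k , k+s∈
    where
    largest≡ = largest-config false (s ∷ [])
    s<k : s < k
    s<k = subst (s <_) 2s≡k (m<m+n s s≥1)
    s≤largest : s ≤ largest (config false (s ∷ []))
    s≤largest = subst (s ≤_) (sym largest≡) (≤-trans (<⇒≤ s<k) (m≤m+n k k))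
    s∉ : mem s (config false (s ∷ [])) ≡ false
    s∉ = trans (mem-select (inConfig false (s ∷ [])) 1 (k + k) s s≥1 (s≤s (≤-trans (<⇒≤ s<k) (m≤m+n k k))))
           (trans (inConfig-below false (s ∷ []) s s<k)
             (cong not (trans (cong (λ w → mem w (s ∷ [])) (trans (cong (_∸ s) (sym 2s≡k)) (m+n∸m≡n s s))) (cong (_∨ false) (≡ᵇ-refl s)))))
    k∉ : k ∉ config false (s ∷ [])
    k∉ = mem≡false⇒∉ k _ (mem-k-config false (s ∷ []))
    k+s∈ : s + k ∈ config false (s ∷ [])
    k+s∈ = ∈-select⁺ (inConfig false (s ∷ [])) 1 (k + k) (s + k) (≤-trans s≥1 (m≤m+n s k)) (s≤s (+-monoˡ-≤ k (<⇒≤ s<k)))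
      (trans (cong (inConfig false (s ∷ [])) (+-comm s k)) (trans (inConfig-above false (s ∷ []) (k + s) (m<m+n k s≥1) (+-monoʳ-< k s<k))
        (trans (cong (λ w → mem w (s ∷ [])) (m+n∸m≡n k s)) (cong (_∨ false) (≡ᵇ-refl s)))))

  count-at : s + s ≡ k → ∀ c → HasCard (IsDistinctPartition s) c → HasCard (IsMaximalUnrefinable N) (1 + c)
  count-at 2s≡k = count-with w uw (largest-config true []) w∉image with-k single
    where
    w = config true []
    uw : IsUnrefinable N w
    uw = config-unrefinable true [] [] [] [] (trans 2s≡k (sym (+-identityʳ k))) (unrefinable-k (s≤s z≤n))
    w∉image : ∀ {B} → IsDistinctPartition s B → w ≢ config false B
    w∉image {B} _ w≡ = true≢false (trans (sym (mem-k-config true [])) (trans (cong (mem k) w≡) (mem-k-config false B)))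
    with-k : ∀ l → IsMaximalUnrefinable N l → mem k l ≡ true → l ≡ w
    with-k l max k∈l = from-config (classify w uw (largest-config true []) l max)
      where
      from-config : ConfigOf l → l ≡ w
      from-config (configOf z B _ B≥1 l≡ 2s≡) = trans l≡ (cong₂ config z≡true (sum≡0⇒[] B B≥1 ΣB≡0))
        where
        z≡true : z ≡ true
        z≡true = trans (sym (mem-k-config z B)) (trans (cong (mem k) (sym l≡)) k∈l)
        ΣB≡0 : sum B ≡ 0
        ΣB≡0 = *-cancelˡ-≡ _ 0 2 (+-cancelˡ-≡ k _ _ (trans (sym (trans 2s≡ (cong (λ b → when b k + 2 * sum B) z≡true)))
                 (trans 2s≡k (sym (+-identityʳ k)))))
    single : ∀ l → IsMaximalUnrefinable N l → l ≡ config false (s ∷ []) → l ≡ w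
    single l ((_ , unref) , _) l≡ = ⊥-elim (unref (subst Refinable (sym l≡) (singleton-refinable 2s≡k)))

  count : ∀ c → HasCard (IsDistinctPartition s) c → HasCard (IsMaximalUnrefinable N) (1 + c)
  count with m≤n⇒m<n∨m≡n 2s≤k
  ... | inj₁ 2s<k = count-below 2s<k
  ... | inj₂ 2s≡k = count-at 2s≡k

module OddConfigFacts (k : ℕ) (k≥2 : 2 ≤ k) where
  open OddConfig k

  k≥1 : 1 ≤ k
  k≥1 = ≤-trans (s≤s z≤n) k≥2

  largest-config : ∀ w B → largest (config w B) ≡ top
  largest-config w B = largest-select (inConfig w B) top (inConfig-top w B)

  mem-above-config : ∀ B x → 1 ≤ x → x ≤ k → mem (k + x) (config false B) ≡ mem (odd x) B
  mem-above-config B x x≥1 x≤k =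
    trans (mem-select (inConfig false B) 1 top (k + x) (≤-trans k≥1 (m≤m+n k x)) (s≤s (≤-trans (+-monoʳ-≤ k x≤k) (n≤1+n _))))
      (trans (inConfig-above false B (k + x) (m<m+n k x≥1) (s≤s (+-monoʳ-≤ k x≤k)))
        (trans (∨-identityʳ _) (cong (λ w → mem (odd w) B) (m+n∸m≡n k x))))

  config-injective : ∀ B B′ → Increasing B → All (λ b → b % 2 ≡ 1) B → All (_< k + k) B →
    Increasing B′ → All (λ b → b % 2 ≡ 1) B′ → All (_< k + k) B′ → config false B ≡ config false B′ → B ≡ B′
  config-injective B B′ B< B-odd B<2k B′< B′-odd B′<2k config≡ =
    trans (sym (map-odd-select-mem k B B< B-odd B<2k)) (trans (cong (map odd) (select-cong 1 k same-mem)) (map-odd-select-mem k B′ B′< B′-odd B′<2k))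
    where
    same-mem : ∀ x → 1 ≤ x → x < 1 + k → mem (odd x) B ≡ mem (odd x) B′
    same-mem x x≥1 x≤k = trans (sym (mem-above-config B x x≥1 (≤-pred x≤k)))
                           (trans (cong (mem (k + x)) config≡) (mem-above-config B′ x x≥1 (≤-pred x≤k)))

  mem-k-config : ∀ w B → mem k (config w B) ≡ not (mem 1 B)
  mem-k-config w B = trans (mem-select (inConfig w B) 1 top k k≥1 (s≤s (≤-trans (m≤m+n k k) (n≤1+n _))))
    (trans (inConfig-below w B k ≤-refl) (cong (λ z → not (mem (odd z) B)) (trans (cong (_∸ k) (+-comm 1 k)) (m+n∸m≡n k 1))))

  mem-k+1-config : ∀ B → mem (suc k) (config false B) ≡ mem 1 B
  mem-k+1-config B = subst (λ z → mem z (config false B) ≡ mem 1 B) (+-comm k 1) (mem-above-config B 1 ≤-refl k≥1)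

  doubled≢exclusive : ∀ B → config true [] ≢ config false B
  doubled≢exclusive B config≡ = by-1∈B (mem 1 B) refl
    where
    open OddConfigPartition k k≥2 using (module Doubled)
    by-1∈B : ∀ b → mem 1 B ≡ b → ⊥
    by-1∈B true 1∈B = true≢false (trans (sym (Doubled.mem-below k k≥1 ≤-refl))
                        (trans (cong (mem k) config≡) (trans (mem-k-config false B) (cong not 1∈B))))
    by-1∈B false 1∉B = true≢false (trans (sym Doubled.mem-k+1) (trans (cong (mem (suc k)) config≡) (trans (mem-k+1-config B) 1∉B)))

module OddClassification (k : ℕ) (k≥2 : 2 ≤ k) (N s : ℕ) (2N≡ : 2 * N ≡ k * (k + 5) + 2 + 2 * (s + s)) (2s≤k+1 : s + s ≤ suc k) where
  open OddConfig k public
  open OddConfigFacts k k≥2 public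
  open OddConfigPartition k k≥2 using (module Exclusive; module Doubled)

  exclusive-unrefinable : ∀ B → Increasing B → All (λ b → b % 2 ≡ 1) B → All (_< k + k) B →
    s + s ≡ sum B → ¬ RefinablePattern (inConfig false B) top → IsUnrefinable N (config false B)
  exclusive-unrefinable B B< B-odd B<2k 2s≡ no-pattern =
    subst (λ w → IsDistinctPartition w (config false B)) sum≡N isDistinctPartition ,
    λ refinable → no-pattern (refinable⇒refinablePattern _ _ (inConfig-top false B) refinable)
    where
    open Exclusive B B< B-odd B<2k using (twice-sum-config≡; isDistinctPartition)
    sum≡N : sum (config false B) ≡ N
    sum≡N = *-cancelˡ-≡ _ _ 2 (trans twice-sum-config≡ (trans (cong (λ w → k * (k + 5) + 2 + 2 * w) (sym 2s≡)) (sym 2N≡)))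

  doubled-unrefinable : s + s ≡ suc k → IsUnrefinable N (config true [])
  doubled-unrefinable 2s≡k+1 =
    subst (λ w → IsDistinctPartition w (config true [])) sum≡N Doubled.isDistinctPartition ,
    λ refinable → unrefinable-doubled (refinable⇒refinablePattern _ _ (inConfig-top true []) refinable)
    where
    sum≡N : sum (config true []) ≡ N
    sum≡N = *-cancelˡ-≡ _ _ 2 (trans Doubled.twice-sum-config≡ (trans (cong (λ w → k * (k + 5) + 2 + 2 * w) (sym 2s≡k+1)) (sym 2N≡)))

  maximal : ∀ l → IsUnrefinable N l → largest l ≡ top → IsMaximalUnrefinable N l
  maximal l u m≡top = u , λ l′ u′ → subst (largest l′ ≤_) (sym m≡top) (largest≤-odd k s k≥1 2N≡ 2s≤k+1 u′)

  maximal⇒largest≡ : ∀ w → IsUnrefinable N w → largest w ≡ top → ∀ l → IsMaximalUnrefinable N l → largest l ≡ top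
  maximal⇒largest≡ w uw w≡top l (u , max) = ≤-antisym (largest≤-odd k s k≥1 2N≡ 2s≤k+1 u) (subst (_≤ largest l) w≡top (max w uw))

  data ConfigOf (l : List ℕ) : Set where
    exclusiveOf : ∀ B → Increasing B → All (1 ≤_) B → All (λ b → b % 2 ≡ 1) B → l ≡ config false B → s + s ≡ sum B → ConfigOf l
    doubledOf : l ≡ config true [] → s + s ≡ suc k → ConfigOf l

  module Classify (l : List ℕ) (u : IsUnrefinable N l) (m≡top : largest l ≡ top) where
    open OddLargestPart (proj₁ u) (unrefinable⇒pairCovered u) k k≥1 m≡top
      using (p; p-top; l≡select; oddAboveHalf; OddShape; exclusive; doubled)
    open OddLargestPart.WithDefect (proj₁ u) (unrefinable⇒pairCovered u) k k≥1 m≡top (s + s) 2N≡ 2s≤k+1 using (shape)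

    upper = select (λ x → p (k + x)) 1 k

    mem-oddAboveHalf : ∀ y → 1 ≤ y → y ≤ k → mem (odd y) oddAboveHalf ≡ p (k + y)
    mem-oddAboveHalf y y≥1 y≤k = trans (mem-odd-map y upper) (mem-select (λ x → p (k + x)) 1 k y y≥1 (s≤s y≤k))

    oddAboveHalf-increasing : Increasing oddAboveHalf
    oddAboveHalf-increasing = map-odd-increasing (select-increasing _ 1 k)

    oddAboveHalf-positive : All (1 ≤_) oddAboveHalf
    oddAboveHalf-positive = map⁺ (All.tabulate λ x∈ → odd-positive (proj₁ (∈-select⁻ _ 1 k _ x∈)))

    oddAboveHalf-odd : All (λ b → b % 2 ≡ 1) oddAboveHalf
    oddAboveHalf-odd = map⁺ (All.tabulate λ {x} x∈ → odd%2≡1 x (proj₁ (∈-select⁻ _ 1 k _ x∈)))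

    top-x : ∀ x → x ≤ k → k + (suc k ∸ x) ≡ top ∸ x
    top-x x x≤k = trans (sym (+-∸-assoc k (≤-trans x≤k (n≤1+n k)))) (cong (_∸ x) (+-suc k k))

    l≡exclusive : Complementary p top k → l ≡ config false oddAboveHalf
    l≡exclusive compl = trans l≡select (trans (cong (select p 1) m≡top) (select-cong 1 top p≡inConfig))
      where
      p≡inConfig : ∀ x → 1 ≤ x → x < 1 + top → p x ≡ inConfig false oddAboveHalf x
      p≡inConfig x x≥1 x≤top with x ≤? k
      ... | yes x≤k = trans (compl x x≥1 x≤k) (trans (cong not (trans (cong p (sym (top-x x x≤k)))
            (sym (mem-oddAboveHalf (suc k ∸ x) (m<n⇒0<n∸m (s≤s x≤k)) (≤-pred (∸-monoʳ-< {m = suc k} {n = x} {o = 0} x≥1 (≤-trans x≤k (n≤1+n k))))))))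
            (sym (inConfig-below false oddAboveHalf x x≤k)))
      ... | no x≰k with m≤n⇒m<n∨m≡n (≤-pred x≤top)
      ...   | inj₂ refl = trans p-top (sym (inConfig-top false oddAboveHalf))
      ...   | inj₁ x<top = trans (cong p (sym (m+[n∸m]≡n (<⇒≤ (≰⇒> x≰k)))))
            (trans (sym (mem-oddAboveHalf (x ∸ k) (m<n⇒0<n∸m (≰⇒> x≰k)) (subst (x ∸ k ≤_) (m+n∸m≡n k k) (∸-monoˡ-≤ k (≤-pred x<top)))))
              (trans (sym (∨-identityʳ _)) (sym (inConfig-above false oddAboveHalf x (≰⇒> x≰k) x<top))))

    l≡doubled : p k ≡ true → p (suc k) ≡ true → (∀ a → 1 ≤ a → a < k → p a ≡ true × p (top ∸ a) ≡ false) → l ≡ config true []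
    l≡doubled pk pk+1 lower = trans l≡select (trans (cong (select p 1) m≡top) (select-cong 1 top p≡inConfig))
      where
      p≡inConfig : ∀ x → 1 ≤ x → x < 1 + top → p x ≡ inConfig true [] x
      p≡inConfig x x≥1 x≤top with x ≤? k
      ... | yes x≤k = trans (present (m≤n⇒m<n∨m≡n x≤k)) (sym (inConfig-below true [] x x≤k))
        where
        present : x < k ⊎ x ≡ k → p x ≡ true
        present (inj₁ x<k) = proj₁ (lower x x≥1 x<k)
        present (inj₂ refl) = pk
      ... | no x≰k with m≤n⇒m<n∨m≡n (≤-pred x≤top)
      ...   | inj₂ refl = trans p-top (sym (inConfig-top true []))
      ...   | inj₁ x<top with x ≟ suc k
      ...     | yes refl = trans pk+1 (sym (trans (inConfig-above true [] (suc k) ≤-refl x<top) (cong (false ∨_) (≡ᵇ-refl (suc k)))))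
      ...     | no x≢k+1 = trans (cong p (sym (m∸[m∸n]≡n (<⇒≤ x<top))))
                  (trans (proj₂ (lower (top ∸ x) (m<n⇒0<n∸m x<top) top-x<k))
                    (sym (trans (inConfig-above true [] x (≰⇒> x≰k) x<top) (≢⇒≡ᵇ-false x (suc k) x≢k+1))))
        where
        top-x<k : top ∸ x < k
        top-x<k with (top ∸ x) <? k
        ... | yes lt = lt
        ... | no nlt = ⊥-elim (n≮n _ (<-≤-trans (subst (_≤ k + x) (trans (+-suc k (suc k)) (cong suc (+-suc k k)))
                                    (+-monoʳ-≤ k (≤∧≢⇒< (≰⇒> x≰k) (λ k+1≡x → x≢k+1 (sym k+1≡x)))))
                        (subst (k + x ≤_) (m∸n+n≡m (<⇒≤ x<top)) (+-monoˡ-≤ x (≮⇒≥ nlt)))))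

    configOf-l : ConfigOf l
    configOf-l = from-shape shape
      where
      from-shape : OddShape (s + s) → ConfigOf l
      from-shape (exclusive compl 2s≡) = exclusiveOf oddAboveHalf oddAboveHalf-increasing oddAboveHalf-positive oddAboveHalf-odd (l≡exclusive compl) 2s≡
      from-shape (doubled 2s≡k+1 pk pk+1 lower) = doubledOf (l≡doubled pk pk+1 lower) 2s≡k+1

  classify : ∀ w → IsUnrefinable N w → largest w ≡ top → ∀ l → IsMaximalUnrefinable N l → ConfigOf l
  classify w uw w≡top l max = Classify.configOf-l l (proj₁ max) (maximal⇒largest≡ w uw w≡top l max)

module OddSingle (k : ℕ) (k≥2 : 2 ≤ k) (N : ℕ) where
  defect-zero : 2 * N ≡ k * (k + 5) + 2 + 2 * 0 → HasCard (IsMaximalUnrefinable N) 1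
  defect-zero 2N≡ = hasCard-single w (maximal w uw (largest-config false [])) is-w
    where
    open OddClassification k k≥2 N 0 2N≡ z≤n
    w = config false []
    uw : IsUnrefinable N w
    uw = exclusive-unrefinable [] [] [] [] refl (OddConfigUnrefinable.unrefinable k [] k≥2 [] [] z≤n (λ ()) (λ ()))
    is-w : ∀ l → IsMaximalUnrefinable N l → l ≡ w
    is-w l max = from-config (classify w uw (largest-config false []) l max)
      where
      from-config : ConfigOf l → l ≡ w
      from-config (exclusiveOf B _ B≥1 _ l≡ 0≡) = trans l≡ (cong (config false) (sum≡0⇒[] B B≥1 (sym 0≡)))

-- For defect 2s with s ≥ 2 and 2s ≤ k + 1, the maximal partitions correspond to the partitions B of 2s into
-- distinct odd parts: B ↦ config false B, except that B = [1, k], whose config is refinable, is sent to config true [].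
module OddCount (k : ℕ) (k≥2 : 2 ≤ k) (s : ℕ) (s≥2 : 2 ≤ s) (N : ℕ)
                (2N≡ : 2 * N ≡ k * (k + 5) + 2 + 2 * (s + s)) (2s≤k+1 : s + s ≤ suc k) where
  open OddClassification k k≥2 N s 2N≡ 2s≤k+1

  edge : List ℕ
  edge = 1 ∷ k ∷ []

  toConfig : List ℕ → List ℕ
  toConfig B with ≡-dec _≟_ B edge
  ... | yes _ = config true []
  ... | no _ = config false B

  parts<2k : ∀ {B} → IsOddDistinctPartition (s + s) B → All (_< k + k) B
  parts<2k {B} ((_ , _ , ΣB≡2s , _) , _) = All.tabulate λ b∈ →
    ≤-<-trans (≤-trans (∈⇒≤sum B b∈) (subst (_≤ suc k) (sym ΣB≡2s) 2s≤k+1)) (subst (_≤ k + k) (+-comm k 2) (+-monoʳ-≤ k k≥2))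

  1≢k : 1 ≢ k
  1≢k 1≡k = n≮n 1 (<-≤-trans (s≤s (s≤s z≤n)) (subst (2 ≤_) (sym 1≡k) k≥2))

  edge-forced : ∀ B → Increasing B → All (1 ≤_) B → 1 ∈ B → k ∈ B → sum B ≡ suc k → B ≡ edge
  edge-forced B B< B≥1 1∈B k∈B ΣB≡k+1 = increasing-ext B< (k≥2 ∷ [-]) ⊆edge edge⊆
    where
    ⊆edge : ∀ x → x ∈ B → x ∈ edge
    ⊆edge x x∈B with x ≟ 1 | x ≟ k
    ... | yes refl | _ = here refl
    ... | no _ | yes refl = there (here refl)
    ... | no x≢1 | no x≢k = ⊥-elim (n≮n _ (<-≤-trans (subst (_< 1 + k + x) (+-identityʳ (1 + k)) (+-monoʳ-< (1 + k) (All.lookup B≥1 x∈B)))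
                              (subst (1 + k + x ≤_) ΣB≡k+1 (three∈⇒≤sum B 1∈B k∈B x∈B 1≢k (λ 1≡x → x≢1 (sym 1≡x)) (λ k≡x → x≢k (sym k≡x))))))
    edge⊆ : ∀ x → x ∈ edge → x ∈ B
    edge⊆ x (here refl) = 1∈B
    edge⊆ x (there (here refl)) = k∈B

  exclusive-maximal : ∀ {B} → IsOddDistinctPartition (s + s) B → B ≢ edge → IsMaximalUnrefinable N (config false B)
  exclusive-maximal {B} dB@((B< , B≥1 , ΣB≡2s , 2≤|B|) , B-odd) B≢edge = maximal (config false B)
    (exclusive-unrefinable B B< B-odd (parts<2k dB) (sym ΣB≡2s)
      (OddConfigUnrefinable.unrefinable k B k≥2 B< B≥1 (subst (_≤ suc k) (sym ΣB≡2s) 2s≤k+1) (∈⇒<sum B 2≤|B| B< B≥1) not-edge))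
    (largest-config false B)
    where
    not-edge : 1 ∈ B → k ∈ B → sum B ≡ suc k → ⊥
    not-edge 1∈B k∈B ΣB≡k+1 = B≢edge (edge-forced B B< B≥1 1∈B k∈B ΣB≡k+1)

  toConfig-maximal : ∀ {B} → IsOddDistinctPartition (s + s) B → IsMaximalUnrefinable N (toConfig B)
  toConfig-maximal {B} dB with ≡-dec _≟_ B edge
  ... | no B≢edge = exclusive-maximal dB B≢edge
  ... | yes refl = maximal (config true []) (doubled-unrefinable (trans (sym (proj₁ (proj₂ (proj₂ (proj₁ dB))))) (cong suc (+-identityʳ k))))
                     (largest-config true [])

  toConfig-injective : ∀ {B B′} → IsOddDistinctPartition (s + s) B → IsOddDistinctPartition (s + s) B′ → toConfig B ≡ toConfig B′ → B ≡ B′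
  toConfig-injective {B} {B′} dB dB′ config≡ with ≡-dec _≟_ B edge | ≡-dec _≟_ B′ edge
  ... | yes refl | yes refl = refl
  ... | yes _ | no _ = ⊥-elim (doubled≢exclusive B′ config≡)
  ... | no _ | yes _ = ⊥-elim (doubled≢exclusive B (sym config≡))
  ... | no _ | no _ = config-injective B B′ (proj₁ (proj₁ dB)) (proj₂ dB) (parts<2k dB) (proj₁ (proj₁ dB′)) (proj₂ dB′) (parts<2k dB′) config≡

  largest-toConfig : ∀ B → largest (toConfig B) ≡ top
  largest-toConfig B with ≡-dec _≟_ B edge
  ... | yes _ = largest-config true []
  ... | no _ = largest-config false B

  -- 2s = k + 1 with 1, k ∈ B: the missing s and k sum to the part k + s.
  edge-refinable : s + s ≡ suc k → Refinable (config false edge)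
  edge-refinable 2s≡k+1 = s , k , (s≥1 , s≤largest , mem≡false⇒∉ s _ s∉) , (k≥1 , k≤largest , mem≡false⇒∉ k _ k∉) , s<k , s+k∈
    where
    s≥1 = ≤-trans (s≤s z≤n) s≥2
    s<k : s < k
    s<k = ≤-pred (subst (_≤ suc k) (+-comm s 2) (subst (s + 2 ≤_) 2s≡k+1 (+-monoʳ-≤ s s≥2)))
    k≤top : k ≤ top
    k≤top = ≤-trans (m≤m+n k k) (n≤1+n _)
    s≤largest = subst (s ≤_) (sym (largest-config false edge)) (≤-trans (<⇒≤ s<k) k≤top)
    k≤largest = subst (k ≤_) (sym (largest-config false edge)) k≤top
    odd-s≡k : odd s ≡ k
    odd-s≡k = cong (_∸ 1) 2s≡k+1
    k-in-edge : mem (odd s) edge ≡ true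
    k-in-edge = trans (cong (λ w → mem w edge) odd-s≡k) (∈⇒mem≡true k edge (there (here refl)))
    s∉ : mem s (config false edge) ≡ false
    s∉ = trans (mem-select (inConfig false edge) 1 top s s≥1 (s≤s (≤-trans (<⇒≤ s<k) k≤top)))
           (trans (inConfig-below false edge s (<⇒≤ s<k))
             (cong not (trans (cong (λ z → mem (odd z) edge) (trans (cong (_∸ s) (sym 2s≡k+1)) (m+n∸m≡n s s)))
               k-in-edge)))
    k∉ : mem k (config false edge) ≡ false
    k∉ = trans (mem-k-config false edge) (cong not (∈⇒mem≡true 1 edge (here refl)))
    s+k∈ : (s + k) ∈ config false edge
    s+k∈ = ∈-select⁺ (inConfig false edge) 1 top (s + k) (≤-trans s≥1 (m≤m+n s k)) (s≤s (≤-trans (+-monoˡ-≤ k (<⇒≤ s<k)) (n≤1+n (k + k))))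
      (trans (cong (inConfig false edge) (+-comm s k))
        (trans (inConfig-above false edge (k + s) (m<m+n k s≥1) (s≤s (+-monoʳ-≤ k (<⇒≤ s<k))))
          (trans (∨-identityʳ _) (trans (cong (λ w → mem (odd w) edge) (m+n∸m≡n k s)) k-in-edge))))

  witness : IsOddDistinctPartition (s + s) (1 ∷ odd s ∷ [])
  witness = ((odd-mono s≥2 ∷ [-]) , (≤-refl ∷ odd-positive s≥1 ∷ []) , sum≡ , s≤s (s≤s z≤n)) , (refl ∷ odd%2≡1 s s≥1 ∷ [])
    where
    s≥1 = ≤-trans (s≤s z≤n) s≥2
    sum≡ : 1 + (odd s + 0) ≡ s + s
    sum≡ = trans (cong suc (+-identityʳ (odd s))) (trans (+-comm 1 (odd s)) (odd+1 s s≥1))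

  two-odd-parts : ∀ B → All (λ b → b % 2 ≡ 1) B → sum B ≡ s + s → 2 ≤ length B
  two-odd-parts [] _ ΣB≡2s = ⊥-elim (n≮n 0 (<-≤-trans (≤-trans (s≤s z≤n) s≥2) (≤-reflexive (m+n≡0⇒m≡0 s (sym ΣB≡2s)))))
  two-odd-parts (b ∷ []) (b-odd ∷ []) ΣB≡2s with () ← trans (sym b-odd) (trans (cong (_% 2) (trans (sym (+-identityʳ b)) ΣB≡2s)) ([h+h]%2≡0 s))
  two-odd-parts (_ ∷ _ ∷ _) _ _ = s≤s (s≤s z≤n)

  count : ∀ c → HasCard (IsOddDistinctPartition (s + s)) c → HasCard (IsMaximalUnrefinable N) c
  count c #D = hasCard-image toConfig toConfig-maximal toConfig-injective #D surjective
    where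
    w = toConfig (1 ∷ odd s ∷ [])
    uw : IsUnrefinable N w
    uw = proj₁ (toConfig-maximal witness)
    surjective : ∀ {l} → IsMaximalUnrefinable N l → Σ (List ℕ) λ B → IsOddDistinctPartition (s + s) B × l ≡ toConfig B
    surjective {l} max = from-config (classify w uw (largest-toConfig (1 ∷ odd s ∷ [])) l max)
      where
      from-config : ConfigOf l → Σ (List ℕ) λ B → IsOddDistinctPartition (s + s) B × l ≡ toConfig B
      from-config (exclusiveOf B B< B≥1 B-odd l≡ 2s≡) = B , dB , trans l≡ (sym toConfig-B)
        where
        dB : IsOddDistinctPartition (s + s) B
        dB = (B< , B≥1 , sym 2s≡ , two-odd-parts B B-odd (sym 2s≡)) , B-odd
        toConfig-B : toConfig B ≡ config false B
        toConfig-B with ≡-dec _≟_ B edge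
        ... | no _ = refl
        ... | yes refl = ⊥-elim (proj₂ (proj₁ max) (subst Refinable (sym l≡) (edge-refinable (trans 2s≡ (cong suc (+-identityʳ k))))))
      from-config (doubledOf l≡ 2s≡k+1) = edge , dEdge , trans l≡ (sym toConfig-edge)
        where
        k-odd : k % 2 ≡ 1
        k-odd = subst (λ z → z % 2 ≡ 1) (cong (_∸ 1) 2s≡k+1) (odd%2≡1 s (≤-trans (s≤s z≤n) s≥2))
        dEdge : IsOddDistinctPartition (s + s) edge
        dEdge = ((k≥2 ∷ [-]) , (≤-refl ∷ k≥1 ∷ []) , trans (cong suc (+-identityʳ k)) (sym 2s≡k+1) , s≤s (s≤s z≤n)) , (refl ∷ k-odd ∷ [])
        toConfig-edge : toConfig edge ≡ config true []
        toConfig-edge with ≡-dec _≟_ edge edge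
        ... | yes _ = refl
        ... | no edge≢edge = ⊥-elim (edge≢edge refl)

twice-T : ∀ n d Y Q → n * suc n ≡ 2 * Y → n * suc n ≡ Q + 2 * d → 2 * T n d ≡ Q
twice-T n d Y Q n[n+1]≡2Y n[n+1]≡Q+2d = begin
  2 * ((n * suc n) / 2 ∸ d)   ≡⟨ *-distribˡ-∸ 2 ((n * suc n) / 2) d ⟩
  2 * ((n * suc n) / 2) ∸ 2 * d ≡⟨ cong (λ z → 2 * z ∸ 2 * d) half≡Y ⟩
  2 * Y ∸ 2 * d               ≡⟨ cong (_∸ 2 * d) (trans (sym n[n+1]≡2Y) n[n+1]≡Q+2d) ⟩
  Q + 2 * d ∸ 2 * d           ≡⟨ m+n∸n≡m Q (2 * d) ⟩
  Q                           ∎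
  where
  open ≡-Reasoning
  half≡Y : (n * suc n) / 2 ≡ Y
  half≡Y = trans (cong (_/ 2) (trans n[n+1]≡2Y (*-comm 2 Y))) (m*n/n≡m Y 2)

n[n+1]-odd : ∀ h → suc (h + h) * suc (suc (h + h)) ≡ 2 * (suc (h + h) * suc h)
n[n+1]-odd = solve-∀

n[n+1]-even : ∀ h → (h + h) * suc (h + h) ≡ 2 * (h * suc (h + h))
n[n+1]-even = solve-∀

half-double : ∀ t → (t + t) / 2 ≡ t
half-double t = trans (cong (_/ 2) (double t)) (m*n/n≡m t 2)
  where double : ∀ t → t + t ≡ t * 2
        double = solve-∀

module OddEven (a t : ℕ) where
  h = 2 + a + t
  n = suc (h + h)
  d = (2 + a) + (2 + a)
  j = 2 + (a + a) + (t + t)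
  s = suc t

  2T≡ : 2 * T n d ≡ suc j * (suc j + 3) + 2 * (s + s)
  2T≡ = twice-T n d (n * suc h) _ (n[n+1]-odd h) (split a t)
    where split : ∀ a t → suc ((2 + a + t) + (2 + a + t)) * suc (suc ((2 + a + t) + (2 + a + t)))
                          ≡ suc (2 + (a + a) + (t + t)) * (suc (2 + (a + a) + (t + t)) + 3) + 2 * (suc t + suc t) + 2 * ((2 + a) + (2 + a))
          split = solve-∀

  2s≤k : s + s ≤ suc j
  2s≤k = subst (s + s ≤_) (rearrange a t) (m≤m+n (s + s) (1 + a + a))
    where rearrange : ∀ a t → (suc t + suc t) + (1 + a + a) ≡ suc (2 + (a + a) + (t + t))
          rearrange = solve-∀

  target≡s : (n ∸ d + 1) / 2 ≡ s
  target≡s = trans (cong (λ z → (z + 1) / 2) (trans (cong (_∸ d) (n≡ a t)) (m+n∸m≡n d (suc (t + t)))))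
               (trans (cong (_/ 2) (rearrange t)) (half-double s))
    where n≡ : ∀ a t → suc ((2 + a + t) + (2 + a + t)) ≡ ((2 + a) + (2 + a)) + suc (t + t)
          n≡ = solve-∀
          rearrange : ∀ t → suc (t + t) + 1 ≡ suc t + suc t
          rearrange = solve-∀

  count : ∀ c → HasCard (IsDistinctPartition ((n ∸ d + 1) / 2)) c → HasCard (IsMaximalUnrefinable (T n d)) (1 + c)
  count c #D = EvenCount.count j (s≤s z≤n) s (s≤s z≤n) (T n d) 2T≡ 2s≤k c (subst (λ z → HasCard (IsDistinctPartition z) c) target≡s #D)

module OddOdd (a t : ℕ) where
  h = 3 + a + t
  n = suc (h + h)
  d = suc ((2 + a) + (2 + a))
  k = 4 + (a + a) + (t + t)
  s = 2 + t

  2T≡ : 2 * T n d ≡ k * (k + 5) + 2 + 2 * (s + s)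
  2T≡ = twice-T n d (n * suc h) _ (n[n+1]-odd h) (split a t)
    where split : ∀ a t → suc ((3 + a + t) + (3 + a + t)) * suc (suc ((3 + a + t) + (3 + a + t)))
                          ≡ (4 + (a + a) + (t + t)) * ((4 + (a + a) + (t + t)) + 5) + 2 + 2 * ((2 + t) + (2 + t)) + 2 * suc ((2 + a) + (2 + a))
          split = solve-∀

  2s≤k+1 : s + s ≤ suc k
  2s≤k+1 = subst (s + s ≤_) (rearrange a t) (m≤m+n (s + s) (1 + a + a))
    where rearrange : ∀ a t → ((2 + t) + (2 + t)) + (1 + a + a) ≡ suc (4 + (a + a) + (t + t))
          rearrange = solve-∀

  target≡2s : n ∸ d + 2 ≡ s + s
  target≡2s = trans (cong (_+ 2) (trans (cong (_∸ d) (n≡ a t)) (m+n∸m≡n d (2 + (t + t))))) (rearrange t)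
    where n≡ : ∀ a t → suc ((3 + a + t) + (3 + a + t)) ≡ suc ((2 + a) + (2 + a)) + (2 + (t + t))
          n≡ = solve-∀
          rearrange : ∀ t → 2 + (t + t) + 2 ≡ (2 + t) + (2 + t)
          rearrange = solve-∀

  count : ∀ c → HasCard (IsOddDistinctPartition (n ∸ d + 2)) c → HasCard (IsMaximalUnrefinable (T n d)) c
  count c #D = OddCount.count k (s≤s (s≤s z≤n)) s (s≤s (s≤s z≤n)) (T n d) 2T≡ 2s≤k+1 c (subst (λ z → HasCard (IsOddDistinctPartition z) c) target≡2s #D)

module EvenOdd (a t : ℕ) where
  h = 2 + a + t
  n = h + h
  d = suc ((1 + a) + (1 + a))
  j = 1 + (a + a) + (t + t)
  s = suc t

  2T≡ : 2 * T n d ≡ suc j * (suc j + 3) + 2 * (s + s)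
  2T≡ = twice-T n d (h * suc n) _ (n[n+1]-even h) (split a t)
    where split : ∀ a t → ((2 + a + t) + (2 + a + t)) * suc ((2 + a + t) + (2 + a + t))
                          ≡ suc (1 + (a + a) + (t + t)) * (suc (1 + (a + a) + (t + t)) + 3) + 2 * (suc t + suc t) + 2 * suc ((1 + a) + (1 + a))
          split = solve-∀

  2s≤k : s + s ≤ suc j
  2s≤k = subst (s + s ≤_) (rearrange a t) (m≤m+n (s + s) (a + a))
    where rearrange : ∀ a t → (suc t + suc t) + (a + a) ≡ suc (1 + (a + a) + (t + t))
          rearrange = solve-∀

  target≡s : (n ∸ d + 1) / 2 ≡ s
  target≡s = trans (cong (λ z → (z + 1) / 2) (trans (cong (_∸ d) (n≡ a t)) (m+n∸m≡n d (suc (t + t)))))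
               (trans (cong (_/ 2) (rearrange t)) (half-double s))
    where n≡ : ∀ a t → (2 + a + t) + (2 + a + t) ≡ suc ((1 + a) + (1 + a)) + suc (t + t)
          n≡ = solve-∀
          rearrange : ∀ t → suc (t + t) + 1 ≡ suc t + suc t
          rearrange = solve-∀

  count : ∀ c → HasCard (IsDistinctPartition ((n ∸ d + 1) / 2)) c → HasCard (IsMaximalUnrefinable (T n d)) (1 + c)
  count c #D = EvenCount.count j (s≤s z≤n) s (s≤s z≤n) (T n d) 2T≡ 2s≤k c (subst (λ z → HasCard (IsDistinctPartition z) c) target≡s #D)

module EvenEven (a t : ℕ) where
  h = 3 + a + t
  n = h + h
  d = (2 + a) + (2 + a)
  k = 3 + (a + a) + (t + t)
  s = 2 + t

  2T≡ : 2 * T n d ≡ k * (k + 5) + 2 + 2 * (s + s)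
  2T≡ = twice-T n d (h * suc n) _ (n[n+1]-even h) (split a t)
    where split : ∀ a t → ((3 + a + t) + (3 + a + t)) * suc ((3 + a + t) + (3 + a + t))
                          ≡ (3 + (a + a) + (t + t)) * ((3 + (a + a) + (t + t)) + 5) + 2 + 2 * ((2 + t) + (2 + t)) + 2 * ((2 + a) + (2 + a))
          split = solve-∀

  2s≤k+1 : s + s ≤ suc k
  2s≤k+1 = subst (s + s ≤_) (rearrange a t) (m≤m+n (s + s) (a + a))
    where rearrange : ∀ a t → ((2 + t) + (2 + t)) + (a + a) ≡ suc (3 + (a + a) + (t + t))
          rearrange = solve-∀

  target≡2s : n ∸ d + 2 ≡ s + s
  target≡2s = trans (cong (_+ 2) (trans (cong (_∸ d) (n≡ a t)) (m+n∸m≡n d (2 + (t + t))))) (rearrange t)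
    where n≡ : ∀ a t → (3 + a + t) + (3 + a + t) ≡ ((2 + a) + (2 + a)) + (2 + (t + t))
          n≡ = solve-∀
          rearrange : ∀ t → 2 + (t + t) + 2 ≡ (2 + t) + (2 + t)
          rearrange = solve-∀

  count : ∀ c → HasCard (IsOddDistinctPartition (n ∸ d + 2)) c → HasCard (IsMaximalUnrefinable (T n d)) c
  count c #D = OddCount.count k (s≤s (s≤s z≤n)) s (s≤s (s≤s z≤n)) (T n d) 2T≡ 2s≤k+1 c (subst (λ z → HasCard (IsOddDistinctPartition z) c) target≡2s #D)

module OddSmall (t : ℕ) where
  h = 2 + t
  n = suc (h + h)

  d≡1 : HasCard (IsMaximalUnrefinable (T n 1)) 1
  d≡1 = EvenSingle.defect-zero (3 + (t + t)) (s≤s z≤n) (T n 1) (twice-T n 1 (n * suc h) _ (n[n+1]-odd h) (split t))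
    where split : ∀ t → suc ((2 + t) + (2 + t)) * suc (suc ((2 + t) + (2 + t)))
                        ≡ suc (3 + (t + t)) * (suc (3 + (t + t)) + 3) + 2 * 0 + 2 * 1
          split = solve-∀

  d≡2 : HasCard (IsMaximalUnrefinable (T n 2)) 1
  d≡2 = OddSingle.defect-zero (3 + (t + t)) (s≤s (s≤s z≤n)) (T n 2) (twice-T n 2 (n * suc h) _ (n[n+1]-odd h) (split t))
    where split : ∀ t → suc ((2 + t) + (2 + t)) * suc (suc ((2 + t) + (2 + t)))
                        ≡ (3 + (t + t)) * ((3 + (t + t)) + 5) + 2 + 2 * 0 + 2 * 2
          split = solve-∀

  d≡3 : HasCard (IsMaximalUnrefinable (T n 3)) 1
  d≡3 = EvenSingle.defect-k (2 + (t + t)) (s≤s z≤n) (T n 3) k-odd (twice-T n 3 (n * suc h) _ (n[n+1]-odd h) (split t))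
    where
    split : ∀ t → suc ((2 + t) + (2 + t)) * suc (suc ((2 + t) + (2 + t)))
                  ≡ suc (2 + (t + t)) * (suc (2 + (t + t)) + 3) + 2 * suc (2 + (t + t)) + 2 * 3
    split = solve-∀
    k-odd : ∀ x → suc (2 + (t + t)) ≢ x + x
    k-odd x k≡2x = even≢odd x (suc t) (trans (trans (2*x≡x+x x) (sym k≡2x)) (rearrange t))
      where rearrange : ∀ t → suc (2 + (t + t)) ≡ suc (2 * suc t)
            rearrange = solve-∀

module EvenSmall (t : ℕ) where
  h = 2 + t
  n = h + h

  d≡1 : HasCard (IsMaximalUnrefinable (T n 1)) 1
  d≡1 = EvenSingle.defect-zero (2 + (t + t)) (s≤s z≤n) (T n 1) (twice-T n 1 (h * suc n) _ (n[n+1]-even h) (split t))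
    where split : ∀ t → ((2 + t) + (2 + t)) * suc ((2 + t) + (2 + t))
                        ≡ suc (2 + (t + t)) * (suc (2 + (t + t)) + 3) + 2 * 0 + 2 * 1
          split = solve-∀

  d≡2 : HasCard (IsMaximalUnrefinable (T n 2)) 1
  d≡2 = OddSingle.defect-zero (2 + (t + t)) (s≤s (s≤s z≤n)) (T n 2) (twice-T n 2 (h * suc n) _ (n[n+1]-even h) (split t))
    where split : ∀ t → ((2 + t) + (2 + t)) * suc ((2 + t) + (2 + t))
                        ≡ (2 + (t + t)) * ((2 + (t + t)) + 5) + 2 + 2 * 0 + 2 * 2
          split = solve-∀

odd-form : ∀ n → n % 2 ≡ 1 → Σ ℕ λ h → n ≡ suc (h + h)
odd-form n n%2≡1 with even-or-odd n
... | inj₂ form = form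
... | inj₁ (h , refl) with () ← trans (sym ([h+h]%2≡0 h)) n%2≡1

even-form : ∀ n → n % 2 ≡ 0 → Σ ℕ λ h → n ≡ h + h
even-form n n%2≡0 with even-or-odd n
... | inj₁ form = form
... | inj₂ (h , refl) with () ← trans (sym ([1+h+h]%2≡1 h)) n%2≡0

≤⇒+ : ∀ {m n} → m ≤ n → Σ ℕ λ t → m + t ≡ n
≤⇒+ {m} {n} m≤n = n ∸ m , m+[n∸m]≡n m≤n

2≤half : ∀ r → 2 < r + r → 2 ≤ r
2≤half (suc (suc r)) _ = s≤s (s≤s z≤n)
2≤half (suc zero) (s≤s (s≤s ()))

half-< : ∀ {r h} → suc (r + r) ≤ h + h → suc r ≤ h
half-< {r} {h} 2r<2h = half-≤ (subst (_≤ suc (h + h)) (cong suc (sym (+-suc r r))) (s≤s 2r<2h))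

≤∸1⇒< : ∀ {x m} → x ≤ m ∸ 1 → 1 ≤ x → x < m
≤∸1⇒< {x} {zero} x≤0 x≥1 = ⊥-elim (n≮n 0 (<-≤-trans x≥1 x≤0))
≤∸1⇒< {x} {suc m} x≤m _ = s≤s x≤m

n-odd-d-even : ∀ n d → d ≤ n ∸ 1 → n % 2 ≡ 1 → 3 < d → d % 2 ≡ 0 → (c : ℕ) →
  HasCard (IsDistinctPartition ((n ∸ d + 1) / 2)) c → HasCard (IsMaximalUnrefinable (T n d)) (1 + c)
n-odd-d-even n d d≤n-1 n-odd 3<d d-even with odd-form n n-odd | even-form d d-even
... | h , refl | r , refl with ≤⇒+ (2≤half r (<-trans (s≤s (s≤s (s≤s z≤n))) 3<d))
...   | a , refl with ≤⇒+ (half-≤ {2 + a} {h} (≤-trans d≤n-1 (n≤1+n _)))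
...     | t , refl = OddEven.count a t

n-odd-d-odd : ∀ n d → d ≤ n ∸ 1 → n % 2 ≡ 1 → 3 < d → d % 2 ≡ 1 → (c : ℕ) →
  HasCard (IsOddDistinctPartition (n ∸ d + 2)) c → HasCard (IsMaximalUnrefinable (T n d)) c
n-odd-d-odd n d d≤n-1 n-odd 3<d d-odd with odd-form n n-odd | odd-form d d-odd
... | h , refl | r , refl with ≤⇒+ (2≤half r (≤-pred 3<d))
...   | a , refl with ≤⇒+ (half-< {2 + a} {h} d≤n-1)
...     | t , refl = OddOdd.count a t

n-odd-d-small : ∀ n d → 11 ≤ n → 1 ≤ d → n % 2 ≡ 1 → d ≤ 3 → HasCard (IsMaximalUnrefinable (T n d)) 1
n-odd-d-small n d 11≤n d≥1 n-odd d≤3 with odd-form n n-odd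
... | h , refl with ≤⇒+ (2≤half h (≤-trans (s≤s (s≤s (s≤s z≤n))) (≤-pred 11≤n)))
...   | t , refl = by-d d d≥1 d≤3
  where
  by-d : ∀ d → 1 ≤ d → d ≤ 3 → HasCard (IsMaximalUnrefinable (T (OddSmall.n t) d)) 1
  by-d 1 _ _ = OddSmall.d≡1 t
  by-d 2 _ _ = OddSmall.d≡2 t
  by-d 3 _ _ = OddSmall.d≡3 t
  by-d (suc (suc (suc (suc _)))) _ (s≤s (s≤s (s≤s ())))

n-even-d-odd : ∀ n d → d ≤ n ∸ 1 → n % 2 ≡ 0 → 2 < d → d % 2 ≡ 1 → (c : ℕ) →
  HasCard (IsDistinctPartition ((n ∸ d + 1) / 2)) c → HasCard (IsMaximalUnrefinable (T n d)) (1 + c)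
n-even-d-odd n d d≤n-1 n-even 2<d d-odd with even-form n n-even | odd-form d d-odd
... | h , refl | suc a , refl with ≤⇒+ (half-< {suc a} {h} (<⇒≤ (≤∸1⇒< d≤n-1 (s≤s z≤n))))
...   | t , refl = EvenOdd.count a t
n-even-d-odd _ _ _ _ (s≤s ()) _ | _ | zero , refl

n-even-d-even : ∀ n d → d ≤ n ∸ 1 → n % 2 ≡ 0 → 2 < d → d % 2 ≡ 0 → (c : ℕ) →
  HasCard (IsOddDistinctPartition (n ∸ d + 2)) c → HasCard (IsMaximalUnrefinable (T n d)) c
n-even-d-even n d d≤n-1 n-even 2<d d-even with even-form n n-even | even-form d d-even
... | h , refl | r , refl with ≤⇒+ (2≤half r 2<d)
...   | a , refl with ≤⇒+ (half-< {2 + a} {h} (≤∸1⇒< d≤n-1 (≤-trans (s≤s z≤n) 2<d)))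
...     | t , refl = EvenEven.count a t

n-even-d-small : ∀ n d → 11 ≤ n → 1 ≤ d → n % 2 ≡ 0 → d ≤ 2 → HasCard (IsMaximalUnrefinable (T n d)) 1
n-even-d-small n d 11≤n d≥1 n-even d≤2 with even-form n n-even
... | h , refl with ≤⇒+ (2≤half h (≤-trans (s≤s (s≤s (s≤s z≤n))) 11≤n))
...   | t , refl = by-d d d≥1 d≤2
  where
  by-d : ∀ d → 1 ≤ d → d ≤ 2 → HasCard (IsMaximalUnrefinable (T (EvenSmall.n t) d)) 1
  by-d 1 _ _ = EvenSmall.d≡1 t
  by-d 2 _ _ = EvenSmall.d≡2 t
  by-d (suc (suc (suc _))) _ (s≤s (s≤s ()))

mainTheorem1 : (n d : ℕ) → 11 ≤ n → 1 ≤ d → d ≤ n ∸ 1 →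
    -- n odd
    ((n % 2 ≡ 1 → 3 < d → d % 2 ≡ 0 → (c : ℕ) →
        HasCard (IsDistinctPartition ((n ∸ d + 1) / 2)) c →
        HasCard (IsMaximalUnrefinable (T n d)) (1 + c))
    × (n % 2 ≡ 1 → 3 < d → d % 2 ≡ 1 → (c : ℕ) →
        HasCard (IsOddDistinctPartition (n ∸ d + 2)) c →
        HasCard (IsMaximalUnrefinable (T n d)) c)
    × (n % 2 ≡ 1 → d ≤ 3 → HasCard (IsMaximalUnrefinable (T n d)) 1)
    -- n even
    × (n % 2 ≡ 0 → 2 < d → d % 2 ≡ 1 → (c : ℕ) →
        HasCard (IsDistinctPartition ((n ∸ d + 1) / 2)) c →
        HasCard (IsMaximalUnrefinable (T n d)) (1 + c))
    × (n % 2 ≡ 0 → 2 < d → d % 2 ≡ 0 → (c : ℕ) →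
        HasCard (IsOddDistinctPartition (n ∸ d + 2)) c →
        HasCard (IsMaximalUnrefinable (T n d)) c)
    × (n % 2 ≡ 0 → d ≤ 2 → HasCard (IsMaximalUnrefinable (T n d)) 1))
mainTheorem1 n d 11≤n d≥1 d≤n-1 =
  n-odd-d-even n d d≤n-1 , n-odd-d-odd n d d≤n-1 , n-odd-d-small n d 11≤n d≥1 ,
  n-even-d-odd n d d≤n-1 , n-even-d-even n d d≤n-1 , n-even-d-small n d 11≤n d≥1
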